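{- Let $(G,\omega)$ be a weighted graph of genus $g=g(G,\omega)$. (1) For every $D\in\operatorname{Div}(G,\omega)$, $r_{(G,\omega)}(D)-r_{(G,\omega)}(K_{(G,\omega)}-D)=\deg D-g+1$. (2) For all $D,D'\in\operatorname{Div}(G)$ with $D\sim D'$ (linear equivalence on $G$), $r_{(G,\omega)}(D)=r_{(G,\omega)}(D')$.
   Context: Graphs are finite and connected, loops and multiple edges allowed. For a graph $H$: $\operatorname{Div}(H)$ is the free abelian group on $V(H)$; for $v\neq w$, $(v\cdot w)$ is the number of edges joining them and $(v\cdot v)=-\operatorname{val}(v)+2\operatorname{loop}(v)$ (valency with loops counted twice, $\operatorname{loop}(v)$ the number of loops at $v$); $T_v=\sum_w(v\cdot w)w$ generate $\operatorname{Prin}(H)$; $D\sim D'$ iff $D-D'\in\operatorname{Prin}(H)$. The rank $r_H(D)$ is $-1$ if no effective divisor is equivalent to $D$, otherwise the maximum $k\ge0$ such that for every effective $E$ of degree $k$ some effective divisor is equivalent to $D-E$. $\widehat H$ denotes $H$ with one new vertex inserted in the interior of each loop-edge, and $r^{\#}_H(D):=r_{\widehat H}(D)$ (extending $D$ by zero). A weighted graph is $(G,\omega)$ with $\omega:V(G)\to\mathbb{Z}_{\ge0}$; its genus is $g(G,\omega)=b_1(G)+\sum_v\omega(v)$. The virtual graph $G^\omega$ is obtained by attaching $\omega(v)$ new loops at each vertex $v$; $V(G^\omega)=V(G)$ and $\operatorname{Div}(G,\omega):=\operatorname{Div}(G^\omega)=\operatorname{Div}(G)$. Define $r_{(G,\omega)}(D):=r^{\#}_{G^\omega}(D)=r_{\widehat{G^\omega}}(D)$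 and $K_{(G,\omega)}:=\sum_{v\in V(G)}(\operatorname{val}_{G^\omega}(v)-2)v$. -}

module Defs where

open import Data.Nat as ℕ using (ℕ; zero; suc)
open import Data.Integer as ℤ using (ℤ; +_; 0ℤ; -1ℤ; _-_; _+_; _*_; -_)
open import Data.Fin as Fin using (Fin; zero; suc)
open import Data.List as List using (List; []; _∷_; _++_; map; allFin; concatMap; replicate; length; foldr)
open import Data.List.Membership.Propositional using (_∈_)
open import Data.Product using (Σ; ∃; _×_; _,_; proj₁; proj₂)
open import Data.Sum using (_⊎_)
open import Data.Bool using (Bool; true; false; if_then_else_; _∧_)
open import Relation.Nullary using (¬_; yes; no; does)
open import Relation.Binary.PropositionalEquality using (_≡_)
open import Function using (id; _∘_)

-- A finite multigraph: vertices Fin n, edges an (unordered-meaning) list of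
-- endpoint pairs; a pair (v , v) is a loop.  Multiple edges = repeated entries.
record Graph : Set where
  constructor mkGraph
  field
    n     : ℕ
    edges : List (Fin n × Fin n)
open Graph public

Div : Graph → Set
Div G = Fin (n G) → ℤ

sumℤ : List ℤ → ℤ
sumℤ = foldr _+_ 0ℤ

sumℕ : List ℕ → ℕ
sumℕ = foldr ℕ._+_ 0

Σᵥ : {m : ℕ} → (Fin m → ℤ) → ℤ
Σᵥ {m} f = sumℤ (map f (allFin m))

eqᵇ : {m : ℕ} → Fin m → Fin m → Bool
eqᵇ a b = does (a Fin.≟ b)

ind : Bool → ℕ
ind true  = 1
ind false = 0

data Reach (G : Graph) : Fin (n G) → Fin (n G) → Set where
  here : ∀ {v} → Reach G v v
  step : ∀ {u v w} → Reach G u v → ((v , w) ∈ edges G ⊎ (w , v) ∈ edges G) → Reach G u w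

Connected : Graph → Set
Connected G = Fin (n G) × (∀ v w → Reach G v w)

-- valency (loops counted twice), number of loops, number of edges joining v,w
val : (G : Graph) → Fin (n G) → ℕ
val G v = sumℕ (map (λ e → ind (eqᵇ (proj₁ e) v) ℕ.+ ind (eqᵇ (proj₂ e) v)) (edges G))

loop : (G : Graph) → Fin (n G) → ℕ
loop G v = sumℕ (map (λ e → ind (eqᵇ (proj₁ e) v ∧ eqᵇ (proj₂ e) v)) (edges G))

joins : (G : Graph) → Fin (n G) → Fin (n G) → ℕ
joins G v w = sumℕ (map (λ e → ind (eqᵇ (proj₁ e) v ∧ eqᵇ (proj₂ e) w)
                               ℕ.+ ind (eqᵇ (proj₁ e) w ∧ eqᵇ (proj₂ e) v)) (edges G))

intersect : (G : Graph) → Fin (n G) → Fin (n G) → ℤ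
intersect G v w with v Fin.≟ w
... | yes _ = - (+ val G v) + + (2 ℕ.* loop G v)
... | no  _ = + joins G v w

T : (G : Graph) → Fin (n G) → Div G
T G v w = intersect G v w

-- Prin(G): the subgroup generated by the T_v, i.e. integer combinations of them
Prin : (G : Graph) → Div G → Set
Prin G D = Σ (Fin (n G) → ℤ) λ f → ∀ w → D w ≡ Σᵥ (λ v → f v * T G v w)

_⊝_ : {m : ℕ} → (Fin m → ℤ) → (Fin m → ℤ) → (Fin m → ℤ)
(D ⊝ E) v = D v - E v

LinEquiv : (G : Graph) → Div G → Div G → Set
LinEquiv G D D' = Prin G (D ⊝ D')

deg : (G : Graph) → Div G → ℤ
deg G D = Σᵥ D

Effective : (G : Graph) → Div G → Set
Effective G D = ∀ v → 0ℤ ℤ.≤ D v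

EquivEff : (G : Graph) → Div G → Set
EquivEff G D = Σ (Div G) λ E → Effective G E × LinEquiv G D E

RankAtLeast : (G : Graph) → Div G → ℕ → Set
RankAtLeast G D k = ∀ E → Effective G E → deg G E ≡ + k → EquivEff G (D ⊝ E)

HasRank : (G : Graph) → Div G → ℤ → Set
HasRank G D r =
  (r ≡ -1ℤ × ¬ EquivEff G D)
  ⊎ (EquivEff G D × Σ ℕ λ k → r ≡ + k × RankAtLeast G D k
                               × (∀ k' → RankAtLeast G D k' → k' ℕ.≤ k))

-- The graph Ĥ: one new vertex inserted in the interior of each loop edge.
-- Built edge by edge; new vertices are added as `zero`, old ones shifted by `suc`.
record HatData (m : ℕ) : Set where
  constructor hd
  field
    size  : ℕ
    hedges : List (Fin size × Fin size)
    emb   : Fin m → Fin size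
    ext   : (Fin m → ℤ) → (Fin size → ℤ)   -- extension by zero

ext0 : {k : ℕ} → (Fin k → ℤ) → Fin (suc k) → ℤ
ext0 E zero    = 0ℤ
ext0 E (suc u) = E u

hatStep : {m : ℕ} → Fin m × Fin m → HatData m → HatData m
hatStep (a , b) (hd s es ι ex) with a Fin.≟ b
... | yes _ = hd (suc s)
                 ((suc (ι a) , zero) ∷ (zero , suc (ι a))
                   ∷ map (λ e → (suc (proj₁ e) , suc (proj₂ e))) es)
                 (suc ∘ ι) (ext0 ∘ ex)
... | no  _ = hd s ((ι a , ι b) ∷ es) ι ex

hatData : (m : ℕ) → List (Fin m × Fin m) → HatData m
hatData m []       = hd m [] id id
hatData m (e ∷ es) = hatStep e (hatData m es)

hat : Graph → Graph
hat G = mkGraph (HatData.size h) (HatData.hedges h)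
  where h = hatData (n G) (edges G)

extHat : (G : Graph) → Div G → Div (hat G)
extHat G = HatData.ext (hatData (n G) (edges G))

HasRank# : (H : Graph) → Div H → ℤ → Set
HasRank# H D r = HasRank (hat H) (extHat H D) r

Weight : Graph → Set
Weight G = Fin (n G) → ℕ

virtual : (G : Graph) → Weight G → Graph
virtual G ω = mkGraph (n G) (edges G ++ concatMap (λ v → replicate (ω v) (v , v)) (allFin (n G)))

-- r_{(G,ω)}(D) = r^#_{G^ω}(D)   (Div(G,ω) = Div(G^ω) = Div(G) = Fin n → ℤ)
HasRankW : (G : Graph) → Weight G → Div G → ℤ → Set
HasRankW G ω D r = HasRank# (virtual G ω) D r

KW : (G : Graph) → Weight G → Div G
KW G ω v = + val (virtual G ω) v - + 2

-- b_1(G) = |E| - |V| + 1 (G connected)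
b1 : Graph → ℤ
b1 G = + length (edges G) - + n G + + 1

genus : (G : Graph) → Weight G → ℤ
genus G ω = b1 G + Σᵥ (λ v → + ω v)

module Submission where

-- By definition the rank on (G , ω) is the rank on H = (G^ω)^, the graph
-- G^ω with every loop subdivided; H is loopless and connected, so it suffices
-- to prove Riemann–Roch on loopless graphs and to transfer K, degree, genus
-- and linear equivalence from G to H.
--
-- Then Baker–Norine:
-- orientation divisors ν ρ of vertex orders ρ are never equivalent to
-- effective divisors and satisfy K - ν ρ = ν (-ρ); by Dhar's burning
-- algorithm every divisor not equivalent to an effective one is equivalent
-- to one below some ν ρ; hence r(D) + 1 is the minimum of deg⁺ (D' - ν ρ),
-- which gives Riemann–Roch.

open import Data.Nat as ℕ using (ℕ; zero; suc; _∸_; _^_)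
import Data.Nat.Properties as ℕP
open import Data.Integer as ℤ using (ℤ; +_; 0ℤ; 1ℤ; -1ℤ; _+_; _*_; -_; _-_; _≤_; _<_)
import Data.Integer.Properties as ℤP
open import Data.Integer.Tactic.RingSolver using (solve-∀)
open import Data.Fin as Fin using (Fin; zero; suc)
import Data.Fin.Properties as FinP
open import Data.Bool using (Bool; true; false; not; _∧_)
import Data.Bool as Bool
open import Data.Bool.Properties using (¬-not)
open import Data.List as List using (List; []; _∷_; _++_; map; length; allFin; tabulate; concatMap; replicate)
import Data.List.Properties as LP
open import Data.List.Membership.Propositional using (_∈_)
open import Data.List.Membership.Propositional.Properties using (∈-++⁺ˡ; ∈-map⁺; ∈-map⁻)
open import Data.List.Relation.Unary.Any using (here; there)
open import Data.Vec using (Vec; []; _∷_)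
open import Data.Vec.Functional using (updateAt)
open import Data.Vec.Functional.Properties using (updateAt-updates; updateAt-minimal)
open import Data.Product using (Σ; _×_; _,_; proj₁; proj₂)
open import Data.Sum using (_⊎_; inj₁; inj₂)
open import Data.Unit using (⊤; tt)
open import Data.Empty using (⊥; ⊥-elim)
open import Relation.Binary.PropositionalEquality hiding ([_])
open import Relation.Nullary using (yes; no; does; ¬_; Dec)
open import Function using (_∘_; id)
open import Function.Definitions using (Injective)
open import Algebra.Properties.Semiring.Sum ℤP.+-*-semiring
  using (sum; sum-cong-≗; ∑-distrib-+; *-distribˡ-sum; sum-replicate-zero)
open import Defs


[_] : Bool → ℤ
[ true ] = 1ℤ
[ false ] = 0ℤ

[]-nonneg : ∀ b → 0ℤ ≤ [ b ]
[]-nonneg true = ℤ.+≤+ ℕ.z≤n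
[]-nonneg false = ℤ.+≤+ ℕ.z≤n

[]-≤1 : ∀ b → [ b ] ≤ 1ℤ
[]-≤1 true = ℤ.+≤+ (ℕ.s≤s ℕ.z≤n)
[]-≤1 false = ℤ.+≤+ ℕ.z≤n

δ : {m : ℕ} → Fin m → Fin m → ℤ
δ a v = [ eqᵇ a v ]

δ-refl : ∀ {m} (a : Fin m) → δ a a ≡ 1ℤ
δ-refl a with a Fin.≟ a
... | yes _ = refl
... | no a≢a = ⊥-elim (a≢a refl)

δ-ne : ∀ {m} {a b : Fin m} → ¬ a ≡ b → δ a b ≡ 0ℤ
δ-ne {a = a} {b} a≢b with a Fin.≟ b
... | yes a≡b = ⊥-elim (a≢b a≡b)
... | no _ = refl

δ-sym : ∀ {m} (a b : Fin m) → δ a b ≡ δ b a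
δ-sym a b with a Fin.≟ b | b Fin.≟ a
... | yes _ | yes _ = refl
... | no _ | no _ = refl
... | yes a≡b | no b≢a = ⊥-elim (b≢a (sym a≡b))
... | no a≢b | yes b≡a = ⊥-elim (a≢b (sym b≡a))

Σᵥ≡sum : ∀ {m} (f : Fin m → ℤ) → Σᵥ f ≡ sum f
Σᵥ≡sum f = go f id
  where
  go : ∀ {m} {A : Set} (F : A → ℤ) (g : Fin m → A) → sumℤ (map F (tabulate g)) ≡ sum (λ v → F (g v))
  go {zero} F g = refl
  go {suc m} F g = cong (λ s → F (g zero) + s) (go F (λ v → g (suc v)))

sum-zero : ∀ {m} → sum {m} (λ _ → 0ℤ) ≡ 0ℤ
sum-zero {m} = sum-replicate-zero m

sum-*ˡ : ∀ {m} (c : ℤ) (f : Fin m → ℤ) → sum (λ v → c * f v) ≡ c * sum f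
sum-*ˡ c f = sym (*-distribˡ-sum c f)

sum-neg : ∀ {m} (f : Fin m → ℤ) → sum (λ v → - f v) ≡ - sum f
sum-neg {zero} f = refl
sum-neg {suc m} f = trans (cong (λ s → - f zero + s) (sum-neg (λ v → f (suc v))))
                          (sym (ℤP.neg-distrib-+ (f zero) _))

sum-- : ∀ {m} (f g : Fin m → ℤ) → sum (λ v → f v - g v) ≡ sum f - sum g
sum-- f g = trans (∑-distrib-+ f (λ v → - g v)) (cong (λ s → sum f + s) (sum-neg g))

sum-mono : ∀ {m} {f g : Fin m → ℤ} → (∀ v → f v ≤ g v) → sum f ≤ sum g
sum-mono {zero} f≤g = ℤP.≤-refl
sum-mono {suc m} f≤g = ℤP.+-mono-≤ (f≤g zero) (sum-mono (λ v → f≤g (suc v)))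

sum-nonneg : ∀ {m} {f : Fin m → ℤ} → (∀ v → 0ℤ ≤ f v) → 0ℤ ≤ sum f
sum-nonneg {m} {f} 0≤f = subst (_≤ sum f) (sum-zero {m}) (sum-mono 0≤f)

sum-const1 : ∀ {m} → sum {m} (λ _ → 1ℤ) ≡ + m
sum-const1 {zero} = refl
sum-const1 {suc m} = trans (cong (λ s → 1ℤ + s) (sum-const1 {m})) (sym (ℤP.pos-+ 1 m))

sum-δ* : ∀ {m} (a : Fin m) (f : Fin m → ℤ) → sum (λ v → δ a v * f v) ≡ f a
sum-δ* {suc m} zero f =
  trans (cong₂ _+_ (ℤP.*-identityˡ (f zero))
                   (trans (sum-cong-≗ (λ v → ℤP.*-zeroˡ (f (suc v)))) (sum-zero {m})))
        (ℤP.+-identityʳ (f zero))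
sum-δ* {suc m} (suc a) f =
  trans (cong₂ _+_ (ℤP.*-zeroˡ (f zero)) (sum-δ* a (λ v → f (suc v)))) (ℤP.+-identityˡ _)

sum-δ : ∀ {m} (a : Fin m) → sum (δ a) ≡ 1ℤ
sum-δ a = trans (sum-cong-≗ (λ v → sym (ℤP.*-identityʳ (δ a v)))) (sum-δ* a (λ _ → 1ℤ))

sum-single : ∀ {m} (a : Fin m) (f : Fin m → ℤ) → (∀ v → ¬ a ≡ v → 0ℤ ≤ f v) → f a ≤ sum f
sum-single a f others≥0 = subst (_≤ sum f) (sum-δ* a f) (sum-mono term)
  where
  term : ∀ v → δ a v * f v ≤ f v
  term v with a Fin.≟ v
  ... | yes _ = ℤP.≤-reflexive (ℤP.*-identityˡ (f v))
  ... | no a≢v = subst (_≤ f v) (sym (ℤP.*-zeroˡ (f v))) (others≥0 v a≢v)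

lsum : {A : Set} → List A → (A → ℤ) → ℤ
lsum L F = sumℤ (map F L)

lsum-cong : ∀ {A : Set} (L : List A) {F G : A → ℤ} → (∀ e → F e ≡ G e) → lsum L F ≡ lsum L G
lsum-cong [] F≡G = refl
lsum-cong (x ∷ L) F≡G = cong₂ _+_ (F≡G x) (lsum-cong L F≡G)

lsum-congᵐ : ∀ {A : Set} (L : List A) {F G : A → ℤ} → (∀ e → e ∈ L → F e ≡ G e) → lsum L F ≡ lsum L G
lsum-congᵐ [] F≡G = refl
lsum-congᵐ (x ∷ L) F≡G = cong₂ _+_ (F≡G x (here refl)) (lsum-congᵐ L (λ e e∈L → F≡G e (there e∈L)))

lsum-+ : ∀ {A : Set} (L : List A) (F G : A → ℤ) → lsum L (λ e → F e + G e) ≡ lsum L F + lsum L G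
lsum-+ [] F G = refl
lsum-+ (x ∷ L) F G = trans (cong (λ s → F x + G x + s) (lsum-+ L F G)) (interchange (F x) (G x) _ _)
  where
  interchange : ∀ a b c d → a + b + (c + d) ≡ a + c + (b + d)
  interchange = solve-∀

lsum-zero : ∀ {A : Set} (L : List A) → lsum L (λ _ → 0ℤ) ≡ 0ℤ
lsum-zero [] = refl
lsum-zero (x ∷ L) = trans (ℤP.+-identityˡ _) (lsum-zero L)

lsum-*ˡ : ∀ {A : Set} (L : List A) (c : ℤ) (F : A → ℤ) → lsum L (λ e → c * F e) ≡ c * lsum L F
lsum-*ˡ [] c F = sym (ℤP.*-zeroʳ c)
lsum-*ˡ (x ∷ L) c F = trans (cong (λ s → c * F x + s) (lsum-*ˡ L c F)) (sym (ℤP.*-distribˡ-+ c (F x) _))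

lsum-neg : ∀ {A : Set} (L : List A) (F : A → ℤ) → lsum L (λ e → - F e) ≡ - lsum L F
lsum-neg [] F = refl
lsum-neg (x ∷ L) F = trans (cong (λ s → - F x + s) (lsum-neg L F)) (sym (ℤP.neg-distrib-+ (F x) _))

lsum-mono : ∀ {A : Set} (L : List A) {F G : A → ℤ} → (∀ e → F e ≤ G e) → lsum L F ≤ lsum L G
lsum-mono [] F≤G = ℤP.≤-refl
lsum-mono (x ∷ L) F≤G = ℤP.+-mono-≤ (F≤G x) (lsum-mono L F≤G)

lsum-mono-surplus : ∀ {A : Set} (L : List A) {F G : A → ℤ} (X : ℤ) {e₀ : A} → (∀ e → F e ≤ G e) → e₀ ∈ L →
                    F e₀ + X ≤ G e₀ → lsum L F + X ≤ lsum L G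
lsum-mono-surplus (x ∷ L) {F} {G} X F≤G (here refl) surplus =
  subst (_≤ lsum (x ∷ L) G) (swap (F x) (lsum L F) X) (ℤP.+-mono-≤ surplus (lsum-mono L F≤G))
  where
  swap : ∀ a b c → a + c + b ≡ a + b + c
  swap = solve-∀
lsum-mono-surplus (x ∷ L) {F} {G} X F≤G (there e₀∈L) surplus =
  subst (_≤ lsum (x ∷ L) G) (sym (ℤP.+-assoc (F x) (lsum L F) X))
        (ℤP.+-mono-≤ (F≤G x) (lsum-mono-surplus L X F≤G e₀∈L surplus))

lsum-const1 : ∀ {A : Set} (L : List A) → lsum L (λ _ → 1ℤ) ≡ + length L
lsum-const1 [] = refl
lsum-const1 (x ∷ L) = trans (cong (λ s → 1ℤ + s) (lsum-const1 L)) (sym (ℤP.pos-+ 1 (length L)))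

lsum-++ : ∀ {A : Set} (L₁ L₂ : List A) (F : A → ℤ) → lsum (L₁ ++ L₂) F ≡ lsum L₁ F + lsum L₂ F
lsum-++ [] L₂ F = sym (ℤP.+-identityˡ _)
lsum-++ (x ∷ L₁) L₂ F = trans (cong (λ s → F x + s) (lsum-++ L₁ L₂ F)) (sym (ℤP.+-assoc (F x) _ _))

lsum-map : ∀ {A B : Set} (g : A → B) (L : List A) (F : B → ℤ) → lsum (map g L) F ≡ lsum L (λ e → F (g e))
lsum-map g [] F = refl
lsum-map g (x ∷ L) F = cong (λ s → F (g x) + s) (lsum-map g L F)

sum-lsum : ∀ {A : Set} {m} (L : List A) (F : A → Fin m → ℤ) →
           sum (λ v → lsum L (λ e → F e v)) ≡ lsum L (λ e → sum (F e))
sum-lsum {m = m} [] F = sum-zero {m}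
sum-lsum (x ∷ L) F = trans (∑-distrib-+ (F x) (λ v → lsum L (λ e → F e v)))
                           (cong (λ s → sum (F x) + s) (sum-lsum L F))

sumℕ-lsum : ∀ {A : Set} (L : List A) (g : A → ℕ) → + sumℕ (map g L) ≡ lsum L (λ e → + g e)
sumℕ-lsum [] g = refl
sumℕ-lsum (x ∷ L) g = trans (ℤP.pos-+ (g x) _) (cong (λ s → + g x + s) (sumℕ-lsum L g))

-- Principal divisors are exactly the Laplacians of potentials.

Edges : ℕ → Set
Edges N = List (Fin N × Fin N)

lapEdge : ∀ {N} → Fin N × Fin N → (Fin N → ℤ) → Fin N → ℤ
lapEdge (a , b) f w = δ b w * (f a - f w) + δ a w * (f b - f w)

lap : ∀ {N} → Edges N → (Fin N → ℤ) → Fin N → ℤ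
lap E f w = lsum E (λ e → lapEdge e f w)

lap-+ : ∀ {N} (E : Edges N) (f g : Fin N → ℤ) w → lap E (λ v → f v + g v) w ≡ lap E f w + lap E g w
lap-+ E f g w = trans (lsum-cong E (λ { (a , b) → ring (δ b w) (δ a w) (f a) (f b) (f w) (g a) (g b) (g w) }))
                      (lsum-+ E (λ e → lapEdge e f w) (λ e → lapEdge e g w))
  where
  ring : ∀ x y fa fb fw ga gb gw → x * (fa + ga - (fw + gw)) + y * (fb + gb - (fw + gw))
                                   ≡ (x * (fa - fw) + y * (fb - fw)) + (x * (ga - gw) + y * (gb - gw))
  ring = solve-∀

lap-* : ∀ {N} (E : Edges N) (c : ℤ) (f : Fin N → ℤ) w → lap E (λ v → c * f v) w ≡ c * lap E f w
lap-* E c f w = trans (lsum-cong E (λ { (a , b) → ring (δ b w) (δ a w) (f a) (f b) (f w) c }))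
                      (lsum-*ˡ E c (λ e → lapEdge e f w))
  where
  ring : ∀ x y fa fb fw c → x * (c * fa - c * fw) + y * (c * fb - c * fw) ≡ c * (x * (fa - fw) + y * (fb - fw))
  ring = solve-∀

lap-neg : ∀ {N} (E : Edges N) (f : Fin N → ℤ) w → lap E (λ v → - f v) w ≡ - lap E f w
lap-neg E f w = trans (lsum-cong E (λ { (a , b) → ring (δ b w) (δ a w) (f a) (f b) (f w) }))
                      (lsum-neg E (λ e → lapEdge e f w))
  where
  ring : ∀ x y fa fb fw → x * (- fa - - fw) + y * (- fb - - fw) ≡ - (x * (fa - fw) + y * (fb - fw))
  ring = solve-∀

lap-zero : ∀ {N} (E : Edges N) w → lap E (λ _ → 0ℤ) w ≡ 0ℤ
lap-zero E w = trans (lsum-cong E (λ { (a , b) → ring (δ b w) (δ a w) })) (lsum-zero E)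
  where
  ring : ∀ x y → x * (0ℤ - 0ℤ) + y * (0ℤ - 0ℤ) ≡ 0ℤ
  ring = solve-∀

private
  sum-endpoints : ∀ {N} (a b : Fin N) (g h : Fin N → ℤ) → sum (λ w → δ b w * g w + δ a w * h w) ≡ g b + h a
  sum-endpoints a b g h = trans (∑-distrib-+ (λ w → δ b w * g w) (λ w → δ a w * h w)) (cong₂ _+_ (sum-δ* b g) (sum-δ* a h))

deg-lap : ∀ {N} (E : Edges N) (f : Fin N → ℤ) → sum (lap E f) ≡ 0ℤ
deg-lap E f = trans (sum-lsum E (λ e w → lapEdge e f w))
  (trans (lsum-cong E (λ { (a , b) → trans (sum-endpoints a b (λ w → f a - f w) (λ w → f b - f w)) (cancel (f a) (f b)) }))
         (lsum-zero E))
  where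
  cancel : ∀ x y → x - y + (y - x) ≡ 0ℤ
  cancel = solve-∀

lap-selfadjoint : ∀ {N} (E : Edges N) (x y : Fin N → ℤ) → sum (λ w → y w * lap E x w) ≡ sum (λ w → x w * lap E y w)
lap-selfadjoint E x y = begin
    sum (λ w → y w * lap E x w)
  ≡⟨ sum-cong-≗ (λ w → sym (lsum-*ˡ E (y w) (λ e → lapEdge e x w))) ⟩
    sum (λ w → lsum E (λ e → y w * lapEdge e x w))
  ≡⟨ sum-lsum E (λ e w → y w * lapEdge e x w) ⟩
    lsum E (λ e → sum (λ w → y w * lapEdge e x w))
  ≡⟨ lsum-cong E (λ { (a , b) → trans (pairing x y a b) (trans (ring (x a) (x b) (y a) (y b)) (sym (pairing y x a b))) }) ⟩
    lsum E (λ e → sum (λ w → x w * lapEdge e y w))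
  ≡⟨ sym (sum-lsum E (λ e w → x w * lapEdge e y w)) ⟩
    sum (λ w → lsum E (λ e → x w * lapEdge e y w))
  ≡⟨ sum-cong-≗ (λ w → lsum-*ˡ E (x w) (λ e → lapEdge e y w)) ⟩
    sum (λ w → x w * lap E y w)
  ∎
  where
  open ≡-Reasoning
  ring : ∀ xa xb ya yb → yb * (xa - xb) + ya * (xb - xa) ≡ xb * (ya - yb) + xa * (yb - ya)
  ring = solve-∀
  distrib : ∀ p q r s t → p * (q * r + s * t) ≡ q * (p * r) + s * (p * t)
  distrib = solve-∀
  pairing : ∀ x y a b → sum (λ w → y w * lapEdge (a , b) x w) ≡ y b * (x a - x b) + y a * (x b - x a)
  pairing x y a b = trans (sum-cong-≗ (λ w → distrib (y w) (δ b w) (x a - x w) (δ a w) (x b - x w)))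
                          (sum-endpoints a b (λ w → y w * (x a - x w)) (λ w → y w * (x b - x w)))

lapEdge-loop : ∀ {N} (a : Fin N) f w → lapEdge (a , a) f w ≡ 0ℤ
lapEdge-loop a f w with a Fin.≟ w
... | yes refl = cong₂ _+_ zero-diff zero-diff
  where
  zero-diff : 1ℤ * (f a - f a) ≡ 0ℤ
  zero-diff = trans (ℤP.*-identityˡ _) (ℤP.+-inverseʳ (f a))
... | no _ = cong₂ _+_ (ℤP.*-zeroˡ (f a - f w)) (ℤP.*-zeroˡ (f a - f w))

edgeIntersect : ∀ {N} → Fin N × Fin N → Fin N → Fin N → ℤ
edgeIntersect (a , b) v w = δ a v * δ b w + δ a w * δ b v - δ v w * (δ a w + δ b w)

private
  indℤ : ∀ b → + ind b ≡ [ b ]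
  indℤ true = refl
  indℤ false = refl

  ind∧ : ∀ x y → + ind (x ∧ y) ≡ [ x ] * [ y ]
  ind∧ true true = refl
  ind∧ true false = refl
  ind∧ false y = sym (ℤP.*-zeroˡ [ y ])

valency : ∀ {N} → Edges N → Fin N → ℤ
valency E x = lsum E (λ e → δ (proj₁ e) x + δ (proj₂ e) x)

valℤ : (G : Graph) (v : Fin (n G)) → + val G v ≡ valency (edges G) v
valℤ G v = trans (sumℕ-lsum (edges G) (λ e → ind (eqᵇ (proj₁ e) v) ℕ.+ ind (eqᵇ (proj₂ e) v)))
  (lsum-cong (edges G) (λ { (a , b) → trans (ℤP.pos-+ (ind (eqᵇ a v)) (ind (eqᵇ b v))) (cong₂ _+_ (indℤ (eqᵇ a v)) (indℤ (eqᵇ b v))) }))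

private
  joinsℤ : (G : Graph) (v w : Fin (n G)) →
           + joins G v w ≡ lsum (edges G) (λ e → δ (proj₁ e) v * δ (proj₂ e) w + δ (proj₁ e) w * δ (proj₂ e) v)
  joinsℤ G v w = trans (sumℕ-lsum (edges G) _) (lsum-cong (edges G) (λ { (a , b) →
    trans (ℤP.pos-+ (ind (eqᵇ a v ∧ eqᵇ b w)) (ind (eqᵇ a w ∧ eqᵇ b v)))
          (cong₂ _+_ (ind∧ (eqᵇ a v) (eqᵇ b w)) (ind∧ (eqᵇ a w) (eqᵇ b v))) }))

  joins-diag : (G : Graph) (v : Fin (n G)) → + joins G v v ≡ + 2 * + loop G v
  joins-diag G v = trans (sumℕ-lsum (edges G) _) (trans (lsum-cong (edges G) twice)
    (trans (lsum-*ˡ (edges G) (+ 2) _) (cong (+ 2 *_) (sym (sumℕ-lsum (edges G) _)))))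
    where
    twice : ∀ e → + (ind (eqᵇ (proj₁ e) v ∧ eqᵇ (proj₂ e) v) ℕ.+ ind (eqᵇ (proj₁ e) v ∧ eqᵇ (proj₂ e) v))
                  ≡ + 2 * + ind (eqᵇ (proj₁ e) v ∧ eqᵇ (proj₂ e) v)
    twice e = trans (ℤP.pos-+ (ind (loopAt e)) (ind (loopAt e))) (doubling (+ ind (loopAt e)))
      where
      loopAt : Fin (n G) × Fin (n G) → Bool
      loopAt e = eqᵇ (proj₁ e) v ∧ eqᵇ (proj₂ e) v
      doubling : ∀ x → x + x ≡ + 2 * x
      doubling = solve-∀

-- (v · w) = joins v w - δ v w · val w; on the diagonal each loop is counted twice in joins.
intersect≡ : (G : Graph) (v w : Fin (n G)) → intersect G v w ≡ + joins G v w - δ v w * + val G w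
intersect≡ G v w with v Fin.≟ w
... | yes refl = trans (cong (λ j → - + val G v + j) (trans (ℤP.pos-* 2 (loop G v)) (sym (joins-diag G v))))
                       (ring (+ val G v) (+ joins G v v))
  where
  ring : ∀ a b → - a + b ≡ b - 1ℤ * a
  ring = solve-∀
... | no _ = sym (trans (cong (λ d → + joins G v w - d) (ℤP.*-zeroˡ (+ val G w))) (ℤP.+-identityʳ _))

intersect-edges : (G : Graph) (v w : Fin (n G)) → intersect G v w ≡ lsum (edges G) (λ e → edgeIntersect e v w)
intersect-edges G v w = begin
    intersect G v w
  ≡⟨ intersect≡ G v w ⟩
    + joins G v w - δ v w * + val G w
  ≡⟨ cong₂ (λ j d → j - δ v w * d) (joinsℤ G v w) (valℤ G w) ⟩
    lsum E joinE - δ v w * lsum E valE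
  ≡⟨ cong (λ s → lsum E joinE - s) (sym (lsum-*ˡ E (δ v w) valE)) ⟩
    lsum E joinE - lsum E (λ e → δ v w * valE e)
  ≡⟨ cong (λ s → lsum E joinE + s) (sym (lsum-neg E (λ e → δ v w * valE e))) ⟩
    lsum E joinE + lsum E (λ e → - (δ v w * valE e))
  ≡⟨ sym (lsum-+ E joinE (λ e → - (δ v w * valE e))) ⟩
    lsum E (λ e → edgeIntersect e v w)
  ∎
  where
  open ≡-Reasoning
  E : Edges (n G)
  E = edges G
  joinE valE : Fin (n G) × Fin (n G) → ℤ
  joinE e = δ (proj₁ e) v * δ (proj₂ e) w + δ (proj₁ e) w * δ (proj₂ e) v
  valE e = δ (proj₁ e) w + δ (proj₂ e) w

sum-edgeIntersect : ∀ {N} (e : Fin N × Fin N) (f : Fin N → ℤ) w → sum (λ v → f v * edgeIntersect e v w) ≡ lapEdge e f w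
sum-edgeIntersect (a , b) f w = begin
    sum (λ v → f v * edgeIntersect (a , b) v w)
  ≡⟨ sum-cong-≗ (λ v → trans (expand (f v) (δ a v) (δ b w) (δ a w) (δ b v) (δ v w)) (cong (λ d → δ a v * (δ b w * f v) + δ b v * (δ a w * f v) - d * (f v * s)) (δ-sym v w))) ⟩
    sum (λ v → δ a v * (δ b w * f v) + δ b v * (δ a w * f v) - δ w v * (f v * s))
  ≡⟨ trans (sum-- (λ v → δ a v * (δ b w * f v) + δ b v * (δ a w * f v)) (λ v → δ w v * (f v * s))) (cong₂ _-_ (∑-distrib-+ (λ v → δ a v * (δ b w * f v)) _) refl) ⟩
    sum (λ v → δ a v * (δ b w * f v)) + sum (λ v → δ b v * (δ a w * f v)) - sum (λ v → δ w v * (f v * s))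
  ≡⟨ cong₂ _-_ (cong₂ _+_ (sum-δ* a (λ v → δ b w * f v)) (sum-δ* b (λ v → δ a w * f v))) (sum-δ* w (λ v → f v * s)) ⟩
    δ b w * f a + δ a w * f b - f w * s
  ≡⟨ collect (δ b w) (δ a w) (f a) (f b) (f w) ⟩
    lapEdge (a , b) f w
  ∎
  where
  open ≡-Reasoning
  s : ℤ
  s = δ a w + δ b w
  expand : ∀ fv av bw aw bv dvw → fv * (av * bw + aw * bv - dvw * (aw + bw)) ≡ av * (bw * fv) + bv * (aw * fv) - dvw * (fv * (aw + bw))
  expand = solve-∀
  collect : ∀ x y fa fb fw → x * fa + y * fb - fw * (y + x) ≡ x * (fa - fw) + y * (fb - fw)
  collect = solve-∀

T-sum≡lap : (G : Graph) (f : Fin (n G) → ℤ) (w : Fin (n G)) → Σᵥ (λ v → f v * T G v w) ≡ lap (edges G) f w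
T-sum≡lap G f w = begin
    Σᵥ (λ v → f v * T G v w)
  ≡⟨ Σᵥ≡sum (λ v → f v * T G v w) ⟩
    sum (λ v → f v * intersect G v w)
  ≡⟨ sum-cong-≗ (λ v → trans (cong (f v *_) (intersect-edges G v w)) (sym (lsum-*ˡ (edges G) (f v) _))) ⟩
    sum (λ v → lsum (edges G) (λ e → f v * edgeIntersect e v w))
  ≡⟨ sum-lsum (edges G) (λ e v → f v * edgeIntersect e v w) ⟩
    lsum (edges G) (λ e → sum (λ v → f v * edgeIntersect e v w))
  ≡⟨ lsum-cong (edges G) (λ e → sum-edgeIntersect e f w) ⟩
    lap (edges G) f w
  ∎
  where open ≡-Reasoning

-- Classical reasoning is confined to the double-negation monad: the
-- existence arguments (maxima of bounded integer functions, case splits on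
-- undecidable properties) produce ¬¬-statements, and the final equalities of
-- integers are decidable, so the double negation is removed at the end.

DN : Set → Set
DN A = ¬ ¬ A

return : {A : Set} → A → DN A
return a k = k a

_>>=_ : {A B : Set} → DN A → (A → DN B) → DN B
(m >>= f) k = m (λ a → f a k)

excluded-middle : {A : Set} → DN (A ⊎ ¬ A)
excluded-middle k = k (inj₂ (λ a → k (inj₁ a)))

DN-elim-dec : {A : Set} → Dec A → DN A → A
DN-elim-dec (yes a) _ = a
DN-elim-dec (no ¬a) ¬¬a = ⊥-elim (¬¬a ¬a)

DN-∀-Fin : ∀ {N} {P : Fin N → Set} → (∀ i → DN (P i)) → DN (∀ i → P i)
DN-∀-Fin {zero} _ k = k (λ ())
DN-∀-Fin {suc N} {P} dn = dn zero >>= λ p₀ → DN-∀-Fin {N} {λ i → P (suc i)} (λ i → dn (suc i)) >>= λ ps →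
  return (λ { zero → p₀ ; (suc i) → ps i })

nonneg : ∀ k → 0ℤ ≤ + k
nonneg k = ℤ.+≤+ ℕ.z≤n

≤-by-difference : {a b : ℤ} (x : ℤ) → 0ℤ ≤ x → x ≡ b - a → a ≤ b
≤-by-difference x 0≤x x≡b-a = ℤP.0≤i-j⇒j≤i (subst (0ℤ ≤_) x≡b-a 0≤x)

0≤+ : {a b : ℤ} → 0ℤ ≤ a → 0ℤ ≤ b → 0ℤ ≤ a + b
0≤+ = ℤP.+-mono-≤

0≤* : {a b : ℤ} → 0ℤ ≤ a → 0ℤ ≤ b → 0ℤ ≤ a * b
0≤* {+ m} {+ n} _ _ = subst (0ℤ ≤_) (ℤP.pos-* m n) (nonneg (m ℕ.* n))

*-monoˡ-≤ : {c x y : ℤ} → 0ℤ ≤ c → x ≤ y → c * x ≤ c * y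
*-monoˡ-≤ {c} 0≤c x≤y = ℤP.*-monoˡ-≤-nonNeg c {{ℤ.nonNegative 0≤c}} x≤y

<⇒+1≤ : {a b : ℤ} → a < b → a + 1ℤ ≤ b
<⇒+1≤ {a} a<b = subst (_≤ _) (ℤP.+-comm 1ℤ a) (ℤP.i<j⇒suc[i]≤j a<b)

+1≤⇒< : {a b : ℤ} → a + 1ℤ ≤ b → a < b
+1≤⇒< {a} a+1≤b = ℤP.suc[i]≤j⇒i<j (subst (_≤ _) (ℤP.+-comm a 1ℤ) a+1≤b)

i≤∣i∣ : ∀ i → i ≤ + ℤ.∣ i ∣
i≤∣i∣ (+ n) = ℤP.≤-refl
i≤∣i∣ ℤ.-[1+ n ] = ℤ.-≤+

-- Proved by induction on the gap
-- between the bound and the value at the starting point.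
maximiser : {A : Set} (P : A → Set) (μ : A → ℤ) (B : ℤ) → (∀ a → P a → μ a ≤ B) → (a₀ : A) → P a₀ →
            DN (Σ A λ a → P a × (∀ b → P b → μ b ≤ μ a))
maximiser {A} P μ B bounded a₀ p₀ = climb (ℤ.∣ B - μ a₀ ∣) a₀ p₀ start
  where
  Goal : Set
  Goal = Σ A λ a → P a × (∀ b → P b → μ b ≤ μ a)
  start : B - + ℤ.∣ B - μ a₀ ∣ ≤ μ a₀
  start = ≤-by-difference (+ ℤ.∣ B - μ a₀ ∣ - (B - μ a₀)) (ℤP.i≤j⇒0≤j-i (i≤∣i∣ (B - μ a₀))) (ring B (μ a₀) (+ ℤ.∣ B - μ a₀ ∣))
    where
    ring : ∀ b m k → k - (b - m) ≡ m - (b - k)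
    ring = solve-∀
  climb : (k : ℕ) (a : A) → P a → B - + k ≤ μ a → DN Goal
  climb k a pa B-k≤μa = excluded-middle {Σ A λ b → P b × μ a < μ b} >>= λ
    { (inj₂ none) → return (a , pa , (λ b pb → ℤP.≮⇒≥ (λ lt → none (b , pb , lt))))
    ; (inj₁ (b , pb , lt)) → improve k B-k≤μa b pb lt }
    where
    improve : (k : ℕ) → B - + k ≤ μ a → (b : A) → P b → μ a < μ b → DN Goal
    improve zero B≤μa b pb μa<μb _ =
      ℤP.<-irrefl refl (ℤP.<-≤-trans (ℤP.≤-<-trans (subst (_≤ μ a) (ℤP.+-identityʳ B) B≤μa) μa<μb) (bounded b pb))
    improve (suc k) B-k-1≤μa b pb μa<μb =
      climb k b pb (ℤP.≤-trans (ℤP.≤-reflexive (shift-gap B k)) (ℤP.≤-trans (ℤP.+-mono-≤ B-k-1≤μa ℤP.≤-refl) (<⇒+1≤ μa<μb)))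
      where
      ring : ∀ B k → B - (1ℤ + k) + 1ℤ ≡ B - k
      ring = solve-∀
      shift-gap : ∀ B k → B - + k ≡ B - + suc k + 1ℤ
      shift-gap B k = sym (trans (cong (λ z → B - z + 1ℤ) (ℤP.pos-+ 1 k)) (ring B (+ k)))

pos : ℤ → ℤ
pos (+ n) = + n
pos ℤ.-[1+ n ] = 0ℤ

pos-nonneg : ∀ x → 0ℤ ≤ pos x
pos-nonneg (+ n) = nonneg n
pos-nonneg ℤ.-[1+ n ] = ℤP.≤-refl

pos-≥ : ∀ x → x ≤ pos x
pos-≥ (+ n) = ℤP.≤-refl
pos-≥ ℤ.-[1+ n ] = ℤ.-≤+

pos-least : ∀ {y z} → y ≤ z → 0ℤ ≤ z → pos y ≤ z
pos-least {+ n} y≤z _ = y≤z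
pos-least {ℤ.-[1+ n ]} _ 0≤z = 0≤z

pos-nonpos : ∀ {x} → x ≤ 0ℤ → pos x ≡ 0ℤ
pos-nonpos {+ zero} _ = refl
pos-nonpos {ℤ.-[1+ n ]} _ = refl
pos-nonpos {+ suc n} (ℤ.+≤+ ())

pos-split : ∀ x → pos x - pos (- x) ≡ x
pos-split (+ zero) = refl
pos-split (+ suc n) = ℤP.+-identityʳ _
pos-split ℤ.-[1+ n ] = refl

module Equivalence (G : Graph) where

  private
    N : ℕ
    N = n G
    E : Edges N
    E = edges G

  infix 4 _≈_
  record _≈_ (D D' : Div G) : Set where
    constructor _by_
    field
      potential : Fin N → ℤ
      equation  : ∀ w → D w ≡ D' w + lap E potential w

  ≈⇒LinEquiv : ∀ {D D'} → D ≈ D' → LinEquiv G D D'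
  ≈⇒LinEquiv {D} {D'} (f by eq) = f , λ w → trans (cong (_- D' w) (eq w)) (trans (ring (D' w) (lap E f w)) (sym (T-sum≡lap G f w)))
    where
    ring : ∀ b c → b + c - b ≡ c
    ring = solve-∀

  LinEquiv⇒≈ : ∀ {D D'} → LinEquiv G D D' → D ≈ D'
  LinEquiv⇒≈ {D} {D'} (f , eq) = f by λ w → trans (sym (ring (D w) (D' w))) (cong (λ s → D' w + s) (trans (eq w) (T-sum≡lap G f w)))
    where
    ring : ∀ a b → b + (a - b) ≡ a
    ring = solve-∀

  ≈-pointwise : ∀ {D D'} → (∀ v → D v ≡ D' v) → D ≈ D'
  ≈-pointwise {D} {D'} D≡D' = (λ _ → 0ℤ) by λ w → trans (D≡D' w) (sym (trans (cong (λ s → D' w + s) (lap-zero E w)) (ℤP.+-identityʳ _)))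

  ≈-sym : ∀ {D D'} → D ≈ D' → D' ≈ D
  ≈-sym {D} {D'} (f by eq) = (λ v → - f v) by λ w → trans (solve-for-D' (D w) (D' w) (lap E f w) (eq w)) (cong (λ s → D w + s) (sym (lap-neg E f w)))
    where
    ring : ∀ b c → b + c + - c ≡ b
    ring = solve-∀
    solve-for-D' : ∀ a b c → a ≡ b + c → b ≡ a + - c
    solve-for-D' a b c a≡b+c = trans (sym (ring b c)) (cong (_+ - c) (sym a≡b+c))

  ≈-trans : ∀ {D₁ D₂ D₃} → D₁ ≈ D₂ → D₂ ≈ D₃ → D₁ ≈ D₃
  ≈-trans {D₁} {D₂} {D₃} (f by eq₁) (g by eq₂) = (λ v → f v + g v) by λ w →
    trans (eq₁ w) (trans (cong (_+ lap E f w) (eq₂ w)) (trans (ring (D₃ w) (lap E g w) (lap E f w)) (cong (λ s → D₃ w + s) (sym (lap-+ E f g w)))))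
    where
    ring : ∀ a b c → a + b + c ≡ a + (c + b)
    ring = solve-∀

  ≈-+ : ∀ {D D'} (X : Div G) → D ≈ D' → (λ v → D v + X v) ≈ (λ v → D' v + X v)
  ≈-+ {D} {D'} X (f by eq) = f by λ w → trans (cong (_+ X w) (eq w)) (ring (D' w) (lap E f w) (X w))
    where
    ring : ∀ a b c → a + b + c ≡ a + c + b
    ring = solve-∀

  ≈-- : ∀ {D D'} (X : Div G) → D ≈ D' → (D ⊝ X) ≈ (D' ⊝ X)
  ≈-- X = ≈-+ (λ v → - X v)

  ≈-neg : ∀ {D D'} → D ≈ D' → (λ v → - D v) ≈ (λ v → - D' v)
  ≈-neg {D} {D'} (f by eq) = (λ v → - f v) by λ w →
    trans (cong -_ (eq w)) (trans (ℤP.neg-distrib-+ (D' w) _) (cong (λ s → - D' w + s) (sym (lap-neg E f w))))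

  ≈-deg : ∀ {D D'} → D ≈ D' → sum D ≡ sum D'
  ≈-deg {D} {D'} (f by eq) = trans (sum-cong-≗ eq) (trans (∑-distrib-+ D' (lap E f)) (trans (cong (λ s → sum D' + s) (deg-lap E f)) (ℤP.+-identityʳ _)))

  EquivEff-resp : ∀ {D D'} → D ≈ D' → EquivEff G D → EquivEff G D'
  EquivEff-resp {D} {D'} D≈D' (F , effF , D~F) = F , effF , ≈⇒LinEquiv (≈-trans (≈-sym D≈D') (LinEquiv⇒≈ D~F))

  RankAtLeast-resp : ∀ {D D'} {k} → D ≈ D' → RankAtLeast G D k → RankAtLeast G D' k
  RankAtLeast-resp D≈D' rank≥k X effX degX = EquivEff-resp (≈-- X D≈D') (rank≥k X effX degX)

  HasRank-resp : ∀ {D D'} {r} → D ≈ D' → HasRank G D r → HasRank G D' r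
  HasRank-resp D≈D' (inj₁ (r≡-1 , ¬eff)) = inj₁ (r≡-1 , λ eff → ¬eff (EquivEff-resp (≈-sym D≈D') eff))
  HasRank-resp D≈D' (inj₂ (eff , k , r≡k , rank≥k , maximal)) =
    inj₂ (EquivEff-resp D≈D' eff , k , r≡k , RankAtLeast-resp D≈D' rank≥k ,
          λ k' rank≥k' → maximal k' (RankAtLeast-resp (≈-sym D≈D') rank≥k'))

  HasRank-unique : ∀ {D r r'} → HasRank G D r → HasRank G D r' → r ≡ r'
  HasRank-unique (inj₁ (r≡-1 , _)) (inj₁ (r'≡-1 , _)) = trans r≡-1 (sym r'≡-1)
  HasRank-unique (inj₁ (_ , ¬eff)) (inj₂ (eff , _)) = ⊥-elim (¬eff eff)
  HasRank-unique (inj₂ (eff , _)) (inj₁ (_ , ¬eff)) = ⊥-elim (¬eff eff)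
  HasRank-unique (inj₂ (_ , k , r≡k , rank≥k , maximal)) (inj₂ (_ , k' , r'≡k' , rank≥k' , maximal')) =
    trans r≡k (trans (cong +_ (ℕP.≤-antisym (maximal' k rank≥k) (maximal k' rank≥k'))) (sym r'≡k'))

  deg≡sum : (D : Div G) → deg G D ≡ sum D
  deg≡sum = Σᵥ≡sum

  vertexSum : ∀ {k} → Vec (Fin N) k → Div G
  vertexSum [] v = 0ℤ
  vertexSum (x ∷ xs) v = δ x v + vertexSum xs v

  vertexSum-effective : ∀ {k} (xs : Vec (Fin N) k) → Effective G (vertexSum xs)
  vertexSum-effective [] v = ℤP.≤-refl
  vertexSum-effective (x ∷ xs) v = 0≤+ ([]-nonneg (eqᵇ x v)) (vertexSum-effective xs v)

  vertexSum-deg : ∀ {k} (xs : Vec (Fin N) k) → sum (vertexSum xs) ≡ + k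
  vertexSum-deg [] = sum-zero {N}
  vertexSum-deg {suc k} (x ∷ xs) = trans (∑-distrib-+ (δ x) (vertexSum xs))
    (trans (cong₂ _+_ (sum-δ x) (vertexSum-deg xs)) (sym (ℤP.pos-+ 1 k)))

  effective-as-vertexSum : ∀ k (X : Div G) → Effective G X → sum X ≡ + k → Σ (Vec (Fin N) k) λ xs → ∀ v → X v ≡ vertexSum xs v
  effective-as-vertexSum zero X effX degX = [] , λ v → ℤP.≤-antisym (subst (X v ≤_) degX (sum-single v X (λ w _ → effX w))) (effX v)
  effective-as-vertexSum (suc k) X effX degX with FinP.any? (λ v → 0ℤ ℤP.<? X v)
  ... | no none = ⊥-elim (ℤP.<-irrefl refl (ℤP.<-≤-trans (ℤ.+<+ (ℕ.s≤s ℕ.z≤n))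
                    (subst (_≤ 0ℤ) degX (subst (sum X ≤_) (sum-zero {N}) (sum-mono (λ v → ℤP.≮⇒≥ (λ lt → none (v , lt))))))))
  ... | yes (x , 0<Xx) with effective-as-vertexSum k (X ⊝ δ x) eff' deg'
    where
    eff' : Effective G (X ⊝ δ x)
    eff' v with x Fin.≟ v
    ... | yes refl = ℤP.i≤j⇒0≤j-i (subst (_≤ X v) (ℤP.+-identityˡ 1ℤ) (<⇒+1≤ 0<Xx))
    ... | no _ = subst (0ℤ ≤_) (sym (ℤP.+-identityʳ (X v))) (effX v)
    deg' : sum (X ⊝ δ x) ≡ + k
    deg' = trans (sum-- X (δ x)) (trans (cong₂ _-_ degX (sum-δ x)) (trans (cong (_- 1ℤ) (ℤP.pos-+ 1 k)) (ring (+ k))))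
      where
      ring : ∀ a → 1ℤ + a - 1ℤ ≡ a
      ring = solve-∀
  ... | xs , X-x≡xs = (x ∷ xs) , λ v → trans (sym (ring (X v) (δ x v))) (cong (λ s → δ x v + s) (X-x≡xs v))
    where
    ring : ∀ a b → b + (a - b) ≡ a
    ring = solve-∀

  -- Rank at least k+1 implies rank at least k: add a vertex q to E and remove it again.
  RankAtLeast-down : ∀ {D k} (q : Fin N) → RankAtLeast G D (suc k) → RankAtLeast G D k
  RankAtLeast-down {D} {k} q rank≥k+1 X effX degX with rank≥k+1 (λ v → X v + δ q v) effX+q degX+q
    where
    effX+q : Effective G (λ v → X v + δ q v)
    effX+q v = 0≤+ (effX v) ([]-nonneg _)
    degX+q : deg G (λ v → X v + δ q v) ≡ + suc k
    degX+q = trans (deg≡sum _) (trans (∑-distrib-+ X (δ q)) (trans (cong₂ _+_ (trans (sym (deg≡sum X)) degX) (sum-δ q))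
               (trans (sym (ℤP.pos-+ k 1)) (cong +_ (ℕP.+-comm k 1)))))
  ... | F , effF , D-X-q~F = (λ v → F v + δ q v) , (λ v → 0≤+ (effF v) ([]-nonneg _)) ,
        ≈⇒LinEquiv (≈-trans (≈-pointwise (λ v → ring (D v) (X v) (δ q v))) (≈-+ (δ q) (LinEquiv⇒≈ {D ⊝ (λ v → X v + δ q v)} {F} D-X-q~F)))
    where
    ring : ∀ d x e → d - x ≡ d - (x + e) + e
    ring = solve-∀

  RankAtLeast-≤ : ∀ {D k k₀} (q : Fin N) → k ℕ.≤ k₀ → RankAtLeast G D k₀ → RankAtLeast G D k
  RankAtLeast-≤ {D} {k₀ = zero} q ℕ.z≤n rank≥k₀ = rank≥k₀
  RankAtLeast-≤ {D} {k = zero} {k₀ = suc k₀} q ℕ.z≤n rank≥k₀ = RankAtLeast-≤ {D} q ℕ.z≤n (RankAtLeast-down {D} q rank≥k₀)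
  RankAtLeast-≤ {D} {k = suc k} {k₀ = suc k₀} q (ℕ.s≤s k≤k₀) rank≥k₀ with ℕP.m≤n⇒m<n∨m≡n k≤k₀
  ... | inj₂ refl = rank≥k₀
  ... | inj₁ k<k₀ = RankAtLeast-≤ {D} q k<k₀ (RankAtLeast-down {D} q rank≥k₀)

⟦_<_⟧ : ℤ → ℤ → ℤ
⟦ a < b ⟧ = [ does (a ℤP.<? b) ]

⟦<⟧-yes : ∀ {a b} → a < b → ⟦ a < b ⟧ ≡ 1ℤ
⟦<⟧-yes {a} {b} a<b with a ℤP.<? b
... | yes _ = refl
... | no a≮b = ⊥-elim (a≮b a<b)

⟦<⟧-no : ∀ {a b} → ¬ a < b → ⟦ a < b ⟧ ≡ 0ℤ
⟦<⟧-no {a} {b} a≮b with a ℤP.<? b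
... | yes a<b = ⊥-elim (a≮b a<b)
... | no _ = refl

⟦<⟧-neg : ∀ x y → ¬ x ≡ y → ⟦ x < y ⟧ + ⟦ - x < - y ⟧ ≡ 1ℤ
⟦<⟧-neg x y x≢y with x ℤP.<? y
... | yes x<y = cong (λ s → 1ℤ + s) (⟦<⟧-no (λ l → ℤP.<-asym l (ℤP.neg-mono-< x<y)))
... | no x≮y = cong (λ s → 0ℤ + s) (⟦<⟧-yes (ℤP.neg-mono-< (ℤP.≤∧≢⇒< (ℤP.≮⇒≥ x≮y) (λ y≡x → x≢y (sym y≡x)))))

⟦<⟧-swap : ∀ x y → ¬ x ≡ y → ⟦ y < x ⟧ + ⟦ x < y ⟧ ≡ 1ℤ
⟦<⟧-swap x y x≢y with x ℤP.<? y
... | yes x<y = cong (_+ 1ℤ) (⟦<⟧-no (ℤP.<-asym x<y))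
... | no x≮y = cong (_+ 0ℤ) (⟦<⟧-yes (ℤP.≤∧≢⇒< (ℤP.≮⇒≥ x≮y) (λ y≡x → x≢y (sym y≡x))))

δ-absorb : ∀ {N} (a v : Fin N) (X : ℤ) → (a ≡ v → X ≡ 1ℤ) → δ a v ≡ δ a v * X
δ-absorb a v X X≡1 with a Fin.≟ v
... | yes a≡v = sym (cong (1ℤ *_) (X≡1 a≡v))
... | no _ = sym (ℤP.*-zeroˡ X)

-- An injective ρ : V → ℤ orders the vertices; orient
-- every edge towards its later end.  ν ρ v = indeg ρ v - 1 is the divisor
-- attached to this orientation; it is never equivalent to an effective
-- divisor, and K - ν ρ = ν (-ρ).
module Orientation {N : ℕ} (E : Edges N) where

  indeg : (Fin N → ℤ) → Fin N → ℤ
  indeg ρ v = lsum E (λ e → δ (proj₁ e) v * ⟦ ρ (proj₂ e) < ρ v ⟧ + δ (proj₂ e) v * ⟦ ρ (proj₁ e) < ρ v ⟧)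

  ν : (Fin N → ℤ) → Fin N → ℤ
  ν ρ v = indeg ρ v - 1ℤ

  Loopless : Set
  Loopless = ∀ e → e ∈ E → ¬ proj₁ e ≡ proj₂ e

  canonical : Fin N → ℤ
  canonical v = valency E v - + 2

  deg⁺ : (Fin N → ℤ) → ℤ
  deg⁺ X = sum (λ v → pos (X v))

  deg⁺-split : (X : Fin N → ℤ) → deg⁺ X - deg⁺ (λ v → - X v) ≡ sum X
  deg⁺-split X = trans (sym (sum-- (λ v → pos (X v)) (λ v → pos (- X v)))) (sum-cong-≗ (λ v → pos-split (X v)))

  -- ν ρ + lap f is never effective: at a vertex v maximising f, and first in
  -- the order among such vertices, every incoming edge comes from a vertex
  -- with smaller f, so the value there is at most -1.
  ν-not-effective : (q : Fin N) (ρ f : Fin N → ℤ) → (∀ w → 0ℤ ≤ ν ρ w + lap E f w) → ⊥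
  ν-not-effective q ρ f effective =
    maximiser (λ _ → ⊤) f bound (λ a _ → absBound f a) q tt λ { (v₁ , _ , f≤fv₁) →
    maximiser (λ w → f w ≡ f v₁) (λ w → - ρ w) (sum (λ w → + ℤ.∣ - ρ w ∣)) (λ a _ → absBound (λ w → - ρ w) a) v₁ refl
      λ { (v , fv≡fv₁ , first) → at-first v₁ f≤fv₁ v fv≡fv₁ first } }
    where
    bound : ℤ
    bound = sum (λ w → + ℤ.∣ f w ∣)
    absBound : (g : Fin N → ℤ) → ∀ v → g v ≤ sum (λ w → + ℤ.∣ g w ∣)
    absBound g v = ℤP.≤-trans (i≤∣i∣ (g v)) (sum-single v (λ w → + ℤ.∣ g w ∣) (λ w _ → nonneg _))
    at-first : (v₁ : Fin N) → (∀ b → ⊤ → f b ≤ f v₁) → (v : Fin N) → f v ≡ f v₁ →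
               (∀ b → f b ≡ f v₁ → - ρ b ≤ - ρ v) → ⊥
    at-first v₁ f≤fv₁ v fv≡fv₁ first = 0≰-1 (ℤP.≤-trans (effective v) value≤-1)
      where
      0≰-1 : ¬ (0ℤ ≤ -1ℤ)
      0≰-1 ()
      f≤fv : ∀ x → f x ≤ f v
      f≤fv x = subst (f x ≤_) (sym fv≡fv₁) (f≤fv₁ x tt)
      neighbour : ∀ x → f x - f v ≤ - ⟦ ρ x < ρ v ⟧
      neighbour x with ρ x ℤP.<? ρ v
      ... | yes ρx<ρv = ≤-by-difference (f v - (f x + 1ℤ)) (ℤP.i≤j⇒0≤j-i (<⇒+1≤ fx<fv)) (ring (f x) (f v))
        where
        ring : ∀ a b → b - (a + 1ℤ) ≡ - 1ℤ - (a - b)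
        ring = solve-∀
        fx<fv : f x < f v
        fx<fv = ℤP.≤∧≢⇒< (f≤fv x) (λ fx≡fv → ℤP.<-irrefl refl (ℤP.<-≤-trans ρx<ρv (ℤP.neg-cancel-≤ (first x (trans fx≡fv fv≡fv₁)))))
      ... | no _ = ≤-by-difference (f v - f x) (ℤP.i≤j⇒0≤j-i (f≤fv x)) (ring (f x) (f v))
        where
        ring : ∀ a b → b - a ≡ - 0ℤ - (a - b)
        ring = solve-∀
      edge : ∀ e → lapEdge e f v ≤ - (δ (proj₁ e) v * ⟦ ρ (proj₂ e) < ρ v ⟧ + δ (proj₂ e) v * ⟦ ρ (proj₁ e) < ρ v ⟧)
      edge (a , b) = subst (_ ≤_) (ring (δ b v) (δ a v) ⟦ ρ a < ρ v ⟧ ⟦ ρ b < ρ v ⟧)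
        (ℤP.+-mono-≤ (*-monoˡ-≤ ([]-nonneg (eqᵇ b v)) (neighbour a)) (*-monoˡ-≤ ([]-nonneg (eqᵇ a v)) (neighbour b)))
        where
        ring : ∀ x y p q → x * - p + y * - q ≡ - (y * q + x * p)
        ring = solve-∀
      value≤-1 : ν ρ v + lap E f v ≤ -1ℤ
      value≤-1 = ℤP.≤-trans (ℤP.+-mono-≤ (ℤP.≤-refl {ν ρ v}) (ℤP.≤-trans (lsum-mono E edge) (ℤP.≤-reflexive (lsum-neg E _))))
                   (ℤP.≤-reflexive (ring (indeg ρ v)))
        where
        ring : ∀ c → c - 1ℤ + - c ≡ -1ℤ
        ring = solve-∀

  -- Reversing the orientation: K - ν ρ = ν (-ρ), since every edge at v is
  -- incoming for exactly one of the two orientations.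
  canonical-ν : Loopless → (ρ : Fin N → ℤ) → Injective _≡_ _≡_ ρ → ∀ v → canonical v - ν ρ v ≡ ν (λ w → - ρ w) v
  canonical-ν loopless ρ ρ-inj v = trans (cong (λ z → z - + 2 - (indeg ρ v - 1ℤ)) split) (ring (indeg ρ v) (indeg ρ' v))
    where
    ρ' : Fin N → ℤ
    ρ' w = - ρ w
    ring : ∀ x y → x + y - + 2 - (x - 1ℤ) ≡ y - 1ℤ
    ring = solve-∀
    distrib : ∀ da db p q r s → da * (p + r) + db * (q + s) ≡ (da * p + db * q) + (da * r + db * s)
    distrib = solve-∀
    split : valency E v ≡ indeg ρ v + indeg ρ' v
    split = trans (lsum-congᵐ E (λ { (a , b) ab∈E →
        trans (cong₂ _+_ (δ-absorb a v _ (λ a≡v → ⟦<⟧-neg (ρ b) (ρ v) (λ r → loopless (a , b) ab∈E (trans a≡v (sym (ρ-inj r))))))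
                         (δ-absorb b v _ (λ b≡v → ⟦<⟧-neg (ρ a) (ρ v) (λ r → loopless (a , b) ab∈E (trans (ρ-inj r) (sym b≡v))))))
              (distrib (δ a v) (δ b v) ⟦ ρ b < ρ v ⟧ ⟦ ρ a < ρ v ⟧ ⟦ ρ' b < ρ' v ⟧ ⟦ ρ' a < ρ' v ⟧) }))
      (lsum-+ E _ _)

  -- deg ν ρ = |E| - |V|: every edge is incoming at exactly one of its ends.
  deg-ν : Loopless → (ρ : Fin N → ℤ) → Injective _≡_ _≡_ ρ → sum (ν ρ) ≡ + length E - + N
  deg-ν loopless ρ ρ-inj = trans (sum-- (indeg ρ) (λ _ → 1ℤ)) (cong₂ _-_ edges-counted (sum-const1 {N}))
    where
    edges-counted : sum (indeg ρ) ≡ + length E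
    edges-counted = trans (sum-lsum E (λ e v → δ (proj₁ e) v * ⟦ ρ (proj₂ e) < ρ v ⟧ + δ (proj₂ e) v * ⟦ ρ (proj₁ e) < ρ v ⟧))
      (trans (lsum-congᵐ E (λ { (a , b) ab∈E →
         trans (∑-distrib-+ (λ v → δ a v * ⟦ ρ b < ρ v ⟧) (λ v → δ b v * ⟦ ρ a < ρ v ⟧))
         (trans (cong₂ _+_ (sum-δ* a (λ v → ⟦ ρ b < ρ v ⟧)) (sum-δ* b (λ v → ⟦ ρ a < ρ v ⟧)))
                (⟦<⟧-swap (ρ a) (ρ b) (λ r → loopless (a , b) ab∈E (ρ-inj r)))) }))
      (lsum-const1 E))

pathLength : ∀ {G u v} → Reach G u v → ℕ
pathLength here = 0
pathLength (step p _) = suc (pathLength p)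

sumℕ-Fin : ∀ {m} → (Fin m → ℕ) → ℕ
sumℕ-Fin {zero} f = 0
sumℕ-Fin {suc m} f = f zero ℕ.+ sumℕ-Fin (λ v → f (suc v))

sumℕ-Fin-≥ : ∀ {m} (f : Fin m → ℕ) v → f v ℕ.≤ sumℕ-Fin f
sumℕ-Fin-≥ f zero = ℕP.m≤m+n _ _
sumℕ-Fin-≥ f (suc v) = ℕP.≤-trans (sumℕ-Fin-≥ (λ v → f (suc v)) v) (ℕP.m≤n+m _ _)

-- A potential that strictly increases away from q: with d the distance to q
-- and K = 2|E| + 1 exceeding every valency, h = K ^ (M - d) satisfies
-- lap h ≥ 1 at every vertex other than q (the neighbour closer to q alone
-- outweighs all other edges).
module Potential (G : Graph) (q : Fin (n G)) where
  private
    N : ℕ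
    N = n G
    E : Edges N
    E = edges G

  Adjacent : Fin N → Fin N → Set
  Adjacent p w = (p , w) ∈ E ⊎ (w , p) ∈ E

  record Distance : Set where
    field
      d : Fin N → ℕ
      d-q : d q ≡ 0
      closer : ∀ w → ¬ w ≡ q → Σ (Fin N) λ p → Adjacent p w × d p ℕ.< d w

  private
    ShortestPath : Fin N → Set
    ShortestPath w = Σ (Reach G q w) λ π → ∀ (π' : Reach G q w) → pathLength π ℕ.≤ pathLength π'

    shortestPath : ∀ w → Reach G q w → DN (ShortestPath w)
    shortestPath w π₀ = maximiser (λ _ → ⊤) (λ π → - + pathLength π) 0ℤ (λ _ _ → ℤP.neg-≤-pos) π₀ tt >>= λ
      { (π , _ , shortest) → return (π , λ π' → ℤP.drop‿+≤+ (ℤP.neg-cancel-≤ (shortest π' tt))) }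

  distance : (∀ w → Reach G q w) → DN Distance
  distance reach = DN-∀-Fin (λ w → shortestPath w (reach w)) >>= λ sp → return (fromPaths sp)
    where
    fromPaths : (∀ w → ShortestPath w) → Distance
    fromPaths sp = record { d = d ; d-q = ℕP.n≤0⇒n≡0 (proj₂ (sp q) here) ; closer = λ w w≢q → last (proj₁ (sp w)) w≢q }
      where
      d : Fin N → ℕ
      d w = pathLength (proj₁ (sp w))
      last : ∀ {w} (π : Reach G q w) → ¬ w ≡ q → Σ (Fin N) λ p → Adjacent p w × d p ℕ.< pathLength π
      last here q≢q = ⊥-elim (q≢q refl)
      last (step {v = v} π' v-w) _ = v , v-w , ℕ.s≤s (proj₂ (sp v) π')

  module Exponential (dist : Distance) where
    open Distance dist

    -- K exceeds every valency.
    K : ℕ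
    K = suc (2 ℕ.* length E)

    h : Fin N → ℤ
    h w = + (K ^ (sumℕ-Fin d ∸ d w))

    h≥1 : ∀ w → 1ℤ ≤ h w
    h≥1 w = ℤ.+≤+ (ℕP.m^n>0 K (sumℕ-Fin d ∸ d w))

    h≥0 : ∀ w → 0ℤ ≤ h w
    h≥0 w = nonneg _

    h≤h-q : ∀ w → h w ≤ h q
    h≤h-q w = ℤ.+≤+ (subst (λ z → K ^ (sumℕ-Fin d ∸ d w) ℕ.≤ K ^ (sumℕ-Fin d ∸ z)) (sym d-q)
                           (ℕP.^-monoʳ-≤ K (ℕP.m∸n≤m (sumℕ-Fin d) (d w))))

    h-closer : ∀ {p w} → d p ℕ.< d w → + K * h w ≤ h p
    h-closer {p} {w} dp<dw = subst (_≤ h p) (ℤP.pos-* K _)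
      (ℤ.+≤+ (ℕP.^-monoʳ-≤ K (ℕP.∸-monoʳ-< dp<dw (sumℕ-Fin-≥ d w))))

    valency≤ : ∀ w → valency E w ≤ + (2 ℕ.* length E)
    valency≤ w = ℤP.≤-trans (lsum-mono E (λ e → ℤP.+-mono-≤ ([]-≤1 (eqᵇ (proj₁ e) w)) ([]-≤1 (eqᵇ (proj₂ e) w))))
      (ℤP.≤-reflexive (trans (lsum-cong E (λ _ → sym (ℤP.*-identityʳ (+ 2)))) (trans (lsum-*ˡ E (+ 2) (λ _ → 1ℤ))
        (trans (cong (+ 2 *_) (lsum-const1 E)) (sym (ℤP.pos-* 2 (length E)))))))

    lap-h≥1 : ∀ w → ¬ w ≡ q → 1ℤ ≤ lap E h w
    lap-h≥1 w w≢q with closer w w≢q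
    ... | p , p~w , dp<dw = begin
        1ℤ              ≤⟨ h≥1 w ⟩
        h w             ≡⟨ sym (ℤP.*-identityʳ (h w)) ⟩
        h w * 1ℤ        ≤⟨ *-monoˡ-≤ (h≥0 w) K-valency≥1 ⟩
        h w * (+ K - valency E w) ≡⟨ sym total ⟩
        lsum E lower + + K * h w ≤⟨ lsum-mono-surplus E (+ K * h w) lower≤ (proj₁ (proj₂ at-p)) (proj₂ (proj₂ at-p)) ⟩
        lap E h w       ∎
      where
      open ℤP.≤-Reasoning
      p≢w : ¬ p ≡ w
      p≢w p≡w = ℕP.<-irrefl (cong d p≡w) dp<dw
      -- every edge term is at least -h w per endpoint at w, since h ≥ 0
      lower : Fin N × Fin N → ℤ
      lower e = - (h w * (δ (proj₁ e) w + δ (proj₂ e) w))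
      lower≤ : ∀ e → lower e ≤ lapEdge e h w
      lower≤ (a , b) = subst (_≤ lapEdge (a , b) h w) (ring (δ b w) (δ a w) (h w))
        (ℤP.+-mono-≤ (*-monoˡ-≤ ([]-nonneg (eqᵇ b w)) (at-least a)) (*-monoˡ-≤ ([]-nonneg (eqᵇ a w)) (at-least b)))
        where
        at-least : ∀ x → - h w ≤ h x - h w
        at-least x = subst (_≤ h x - h w) (ℤP.+-identityˡ (- h w)) (ℤP.+-mono-≤ (h≥0 x) (ℤP.≤-refl { - h w}))
        ring : ∀ x y P → x * - P + y * - P ≡ - (P * (y + x))
        ring = solve-∀
      K-valency≥1 : 1ℤ ≤ + K - valency E w
      K-valency≥1 = ≤-by-difference (+ (2 ℕ.* length E) - valency E w) (ℤP.i≤j⇒0≤j-i (valency≤ w))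
        (trans (ring (+ (2 ℕ.* length E)) (valency E w)) (cong (λ z → z - valency E w - 1ℤ) (ℤP.pos-+ 1 (2 ℕ.* length E))))
        where
        ring : ∀ a v → a - v ≡ 1ℤ + a - v - 1ℤ
        ring = solve-∀
      total : lsum E lower + + K * h w ≡ h w * (+ K - valency E w)
      total = trans (cong (λ z → z + + K * h w) (trans (lsum-neg E _) (cong -_ (lsum-*ˡ E (h w) (λ e → δ (proj₁ e) w + δ (proj₂ e) w)))))
                    (ring (h w) (+ K) (valency E w))
        where
        ring : ∀ P k v → - (P * v) + k * P ≡ P * (k - v)
        ring = solve-∀
      -- the edge to the closer neighbour p contributes h p - h w ≥ K h w - h w
      closer-edge : ∀ e → e ≡ (p , w) ⊎ e ≡ (w , p) → lower e + + K * h w ≤ lapEdge e h w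
      closer-edge e e≡ = subst₂ _≤_ (sym (lower≡ e≡)) (sym (lap≡ e≡)) (ℤP.+-mono-≤ (h-closer dp<dw) ℤP.≤-refl)
        where
        ring₁ : ∀ P k → - (P * (0ℤ + 1ℤ)) + k * P ≡ k * P - P
        ring₁ = solve-∀
        ring₂ : ∀ P k → - (P * (1ℤ + 0ℤ)) + k * P ≡ k * P - P
        ring₂ = solve-∀
        ring₃ : ∀ a P → 1ℤ * (a - P) + 0ℤ * (P - P) ≡ a - P
        ring₃ = solve-∀
        ring₄ : ∀ a P → 0ℤ * (P - P) + 1ℤ * (a - P) ≡ a - P
        ring₄ = solve-∀
        lower≡ : e ≡ (p , w) ⊎ e ≡ (w , p) → lower e + + K * h w ≡ + K * h w - h w
        lower≡ (inj₁ refl) = trans (cong₂ (λ x y → - (h w * (x + y)) + + K * h w) (δ-ne p≢w) (δ-refl w)) (ring₁ (h w) (+ K))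
        lower≡ (inj₂ refl) = trans (cong₂ (λ x y → - (h w * (x + y)) + + K * h w) (δ-refl w) (δ-ne p≢w)) (ring₂ (h w) (+ K))
        lap≡ : e ≡ (p , w) ⊎ e ≡ (w , p) → lapEdge e h w ≡ h p - h w
        lap≡ (inj₁ refl) = trans (cong₂ (λ x y → x * (h p - h w) + y * (h w - h w)) (δ-refl w) (δ-ne p≢w)) (ring₃ (h p) (h w))
        lap≡ (inj₂ refl) = trans (cong₂ (λ x y → x * (h w - h w) + y * (h p - h w)) (δ-ne p≢w) (δ-refl w)) (ring₄ (h p) (h w))
      at-p : Σ (Fin N × Fin N) λ e → e ∈ E × (lower e + + K * h w ≤ lapEdge e h w)
      at-p = edge-at p~w
        where
        edge-at : Adjacent p w → Σ (Fin N × Fin N) λ e → e ∈ E × (lower e + + K * h w ≤ lapEdge e h w)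
        edge-at (inj₁ pw∈E) = (p , w) , pw∈E , closer-edge (p , w) (inj₁ refl)
        edge-at (inj₂ wp∈E) = (w , p) , wp∈E , closer-edge (w , p) (inj₂ refl)

set : ∀ {m} {A : Set} → (Fin m → A) → Fin m → A → Fin m → A
set f v a = updateAt f v (λ _ → a)

set-here : ∀ {m} {A : Set} (f : Fin m → A) v a → set f v a v ≡ a
set-here f v a = updateAt-updates v f

set-elsewhere : ∀ {m} {A : Set} (f : Fin m → A) {v x} a → ¬ v ≡ x → set f v a x ≡ f x
set-elsewhere f {v} {x} a v≢x = updateAt-minimal x v f (λ x≡v → v≢x (sym x≡v))

-- Dhar's burning algorithm for a divisor D with D q < 0.  A fire starts at q
-- and a vertex v catches fire once D v is smaller than the number of its
-- edges to burnt vertices.  Either everything burns, and the burning times ρ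
-- give D ≤ ν ρ, or the fire stops with a nonempty unburnt set all of whose
-- vertices satisfy D v ≥ (number of edges to the burnt set).
module Burning {N : ℕ} (E : Edges N) (D : Fin N → ℤ) where
  open Orientation E

  edgesTo : (Fin N → Bool) → Fin N → ℤ
  edgesTo b v = lsum E (λ e → δ (proj₁ e) v * [ b (proj₂ e) ] + δ (proj₂ e) v * [ b (proj₁ e) ])

  edgesToEarlier : (Fin N → Bool) → (Fin N → ℤ) → Fin N → ℤ
  edgesToEarlier b ρ v = lsum E (λ e → δ (proj₁ e) v * ([ b (proj₂ e) ] * ⟦ ρ (proj₂ e) < ρ v ⟧)
                                     + δ (proj₂ e) v * ([ b (proj₁ e) ] * ⟦ ρ (proj₁ e) < ρ v ⟧))

  edgesToEarlier-cong : ∀ b ρ b' ρ' v → (∀ x → [ b x ] * ⟦ ρ x < ρ v ⟧ ≡ [ b' x ] * ⟦ ρ' x < ρ' v ⟧) →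
                        edgesToEarlier b ρ v ≡ edgesToEarlier b' ρ' v
  edgesToEarlier-cong b ρ b' ρ' v same =
    lsum-cong E (λ e → cong₂ _+_ (cong (δ (proj₁ e) v *_) (same (proj₂ e))) (cong (δ (proj₂ e) v *_) (same (proj₁ e))))

  edgesTo-nonneg : ∀ b v → 0ℤ ≤ edgesTo b v
  edgesTo-nonneg b v = subst (_≤ edgesTo b v) (lsum-zero E) (lsum-mono E (λ e →
    0≤+ (0≤* ([]-nonneg (eqᵇ (proj₁ e) v)) ([]-nonneg (b (proj₂ e)))) (0≤* ([]-nonneg (eqᵇ (proj₂ e) v)) ([]-nonneg (b (proj₁ e))))))

  record Stage : Set where
    constructor stage
    field
      burnt : Fin N → Bool
      time  : Fin N → ℤ
      clock : ℤ

  Consistent : Stage → Set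
  Consistent (stage b ρ t) = (∀ v → b v ≡ true → ρ v < t)
                           × (∀ v → b v ≡ true → D v < edgesToEarlier b ρ v)
                           × (∀ v w → b v ≡ true → b w ≡ true → ρ v ≡ ρ w → v ≡ w)

  -- Number of burnt vertices; it is bounded by N, so the fire can be maximised.
  burntCount : Stage → ℤ
  burntCount s = sum (λ v → [ Stage.burnt s v ])

  burntCount≤ : ∀ s → burntCount s ≤ + N
  burntCount≤ s = subst (burntCount s ≤_) (sum-const1 {N}) (sum-mono (λ v → []-≤1 (Stage.burnt s v)))

  burn-one : (s : Stage) → Consistent s → (v : Fin N) → Stage.burnt s v ≡ false → D v < edgesTo (Stage.burnt s) v →
             Σ Stage λ s' → Consistent s' × (burntCount s + 1ℤ ≤ burntCount s')
  burn-one (stage b ρ t) (before , because , distinct) v unburnt catches =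
    stage b' ρ' (t + 1ℤ) , (before' , because' , distinct') , ℤP.≤-reflexive count'
    where
    b' : Fin N → Bool
    b' = set b v true
    ρ' : Fin N → ℤ
    ρ' = set ρ v t
    t<t+1 : t < t + 1ℤ
    t<t+1 = +1≤⇒< ℤP.≤-refl
    was-burnt : ∀ {u} → ¬ v ≡ u → b' u ≡ true → b u ≡ true
    was-burnt v≢u b'u = trans (sym (set-elsewhere b true v≢u)) b'u
    before' : ∀ u → b' u ≡ true → ρ' u < t + 1ℤ
    before' u b'u with v Fin.≟ u
    ... | yes refl = subst (_< t + 1ℤ) (sym (set-here ρ v t)) t<t+1
    ... | no v≢u = subst (_< t + 1ℤ) (sym (set-elsewhere ρ t v≢u)) (ℤP.<-trans (before u (was-burnt v≢u b'u)) t<t+1)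
    new-time : ∀ {u} → ¬ v ≡ u → b u ≡ true → ¬ ρ' v ≡ ρ' u
    new-time v≢u bu same = ℤP.<-irrefl (sym (trans (sym (set-here ρ v t)) (trans same (set-elsewhere ρ t v≢u)))) (before _ bu)
    distinct' : ∀ u w → b' u ≡ true → b' w ≡ true → ρ' u ≡ ρ' w → u ≡ w
    distinct' u w b'u b'w same with v Fin.≟ u | v Fin.≟ w
    ... | yes refl | yes refl = refl
    ... | yes refl | no v≢w = ⊥-elim (new-time v≢w (was-burnt v≢w b'w) same)
    ... | no v≢u | yes refl = ⊥-elim (new-time v≢u (was-burnt v≢u b'u) (sym same))
    ... | no v≢u | no v≢w = distinct u w (was-burnt v≢u b'u) (was-burnt v≢w b'w)
                              (trans (sym (set-elsewhere ρ t v≢u)) (trans same (set-elsewhere ρ t v≢w)))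
    earlier-at-v : ∀ x → [ b x ] ≡ [ b' x ] * ⟦ ρ' x < t ⟧
    earlier-at-v x with v Fin.≟ x
    ... | yes refl = trans (cong [_] unburnt) (sym (trans (cong₂ (λ p r → [ p ] * ⟦ r < t ⟧) (set-here b v true) (set-here ρ v t))
                        (cong (1ℤ *_) (⟦<⟧-no {t} {t} (ℤP.<-irrefl refl)))))
    ... | no v≢x = other (b x) refl
      where
      other : ∀ c → b x ≡ c → [ b x ] ≡ [ b' x ] * ⟦ ρ' x < t ⟧
      other true bx = trans (cong [_] bx) (sym (trans (cong₂ (λ p r → [ p ] * ⟦ r < t ⟧) (trans (set-elsewhere b true v≢x) bx) (set-elsewhere ρ t v≢x))
                        (cong (1ℤ *_) (⟦<⟧-yes (before x bx)))))
      other false bx = trans (cong [_] bx) (sym (trans (cong (λ p → [ p ] * ⟦ ρ' x < t ⟧) (trans (set-elsewhere b true v≢x) bx)) (ℤP.*-zeroˡ ⟦ ρ' x < t ⟧)))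
    -- for an old burnt vertex u, v comes later, so nothing changes at u
    earlier-at-old : ∀ u → b u ≡ true → ¬ v ≡ u → ∀ x → [ b x ] * ⟦ ρ x < ρ u ⟧ ≡ [ b' x ] * ⟦ ρ' x < ρ' u ⟧
    earlier-at-old u bu v≢u x = trans (unchanged x) (cong (λ z → [ b' x ] * ⟦ ρ' x < z ⟧) (sym (set-elsewhere ρ t v≢u)))
      where
      unchanged : ∀ x → [ b x ] * ⟦ ρ x < ρ u ⟧ ≡ [ b' x ] * ⟦ ρ' x < ρ u ⟧
      unchanged x with v Fin.≟ x
      ... | yes refl = trans (cong (λ p → [ p ] * ⟦ ρ v < ρ u ⟧) unburnt)
                        (trans (ℤP.*-zeroˡ ⟦ ρ v < ρ u ⟧) (sym (trans (cong₂ (λ p r → [ p ] * ⟦ r < ρ u ⟧) (set-here b v true) (set-here ρ v t))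
                          (cong (1ℤ *_) (⟦<⟧-no {t} {ρ u} (ℤP.<-asym (before u bu)))))))
      ... | no v≢x = cong₂ (λ p r → [ p ] * ⟦ r < ρ u ⟧) (sym (set-elsewhere b true v≢x)) (sym (set-elsewhere ρ t v≢x))
    because' : ∀ u → b' u ≡ true → D u < edgesToEarlier b' ρ' u
    because' u b'u with v Fin.≟ u
    ... | yes refl = subst (D v <_) (lsum-cong E (λ e → cong₂ _+_
                        (cong (δ (proj₁ e) v *_) (trans (earlier-at-v (proj₂ e)) (cong (λ z → [ b' (proj₂ e) ] * ⟦ ρ' (proj₂ e) < z ⟧) (sym (set-here ρ v t)))))
                        (cong (δ (proj₂ e) v *_) (trans (earlier-at-v (proj₁ e)) (cong (λ z → [ b' (proj₁ e) ] * ⟦ ρ' (proj₁ e) < z ⟧) (sym (set-here ρ v t))))))) catches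
    ... | no v≢u = subst (D u <_) (edgesToEarlier-cong b ρ b' ρ' u (earlier-at-old u (was-burnt v≢u b'u) v≢u)) (because u (was-burnt v≢u b'u))
    count' : sum (λ u → [ b u ]) + 1ℤ ≡ sum (λ u → [ b' u ])
    count' = sym (trans (sum-cong-≗ one-more) (trans (∑-distrib-+ (λ u → [ b u ]) (δ v)) (cong (λ s → sum (λ u → [ b u ]) + s) (sum-δ v))))
      where
      one-more : ∀ u → [ b' u ] ≡ [ b u ] + δ v u
      one-more u with v Fin.≟ u
      ... | yes refl = trans (cong [_] (set-here b v true)) (cong₂ _+_ (cong [_] (sym unburnt)) refl)
      ... | no v≢u = trans (cong [_] (set-elsewhere b true v≢u)) (sym (ℤP.+-identityʳ _))

  Outcome : Fin N → Set
  Outcome q = (Σ (Fin N → ℤ) λ ρ → Injective _≡_ _≡_ ρ × (∀ v → D v ≤ ν ρ v))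
            ⊎ (Σ (Fin N → Bool) λ b → b q ≡ true × (Σ (Fin N) λ w₀ → b w₀ ≡ false) × (∀ v → b v ≡ false → edgesTo b v ≤ D v))

  -- Run the fire to a maximal consistent stage and read off the outcome.
  burning : (q : Fin N) → D q < 0ℤ → DN (Outcome q)
  burning q Dq<0 = maximiser Consistent burntCount (+ N) (λ s _ → burntCount≤ s) initial initial-consistent >>= λ { (s , cs , maximal) →
      excluded-middle {Σ (Fin N) λ v → Stage.burnt s v ≡ false × D v < edgesTo (Stage.burnt s) v} >>= λ
      { (inj₁ (v , unburnt , catches)) → λ _ → let (s' , cs' , more) = burn-one s cs v unburnt catches in
             ℤP.<-irrefl refl (ℤP.<-≤-trans (+1≤⇒< more) (maximal s' cs'))
      ; (inj₂ stopped) → return (outcome s cs stopped) } }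
    where
    initial : Stage
    initial = stage (λ _ → false) (λ _ → 0ℤ) 0ℤ
    initial-consistent : Consistent initial
    initial-consistent = (λ v ()) , (λ v ()) , (λ v w ())
    outcome : (s : Stage) → Consistent s → ¬ (Σ (Fin N) λ v → Stage.burnt s v ≡ false × D v < edgesTo (Stage.burnt s) v) → Outcome q
    outcome (stage b ρ t) (before , because , distinct) stopped with FinP.all? (λ v → b v Bool.≟ true)
    ... | yes all-burnt = inj₁ (ρ , (λ {v} {w} same → distinct v w (all-burnt v) (all-burnt w) same) ,
                            λ v → <⇒≤-1 (subst (D v <_) (lsum-cong E (λ e → cong₂ _+_ (cong (δ (proj₁ e) v *_) (burnt-factor (proj₂ e) _))
                                                                                (cong (δ (proj₂ e) v *_) (burnt-factor (proj₁ e) _)))) (because v (all-burnt v))))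
      where
      burnt-factor : ∀ x y → [ b x ] * y ≡ y
      burnt-factor x y = trans (cong (λ z → [ z ] * y) (all-burnt x)) (ℤP.*-identityˡ y)
      <⇒≤-1 : ∀ {a c} → a < c → a ≤ c - 1ℤ
      <⇒≤-1 {a} {c} a<c = ≤-by-difference (c - (a + 1ℤ)) (ℤP.i≤j⇒0≤j-i (<⇒+1≤ a<c)) (ring a c)
        where
        ring : ∀ a c → c - (a + 1ℤ) ≡ c - 1ℤ - a
        ring = solve-∀
    ... | no not-all = inj₂ (b , q-burnt , unburnt-vertex , λ v bv → ℤP.≮⇒≥ (λ lt → stopped (v , bv , lt)))
      where
      unburnt-vertex : Σ (Fin N) λ w → b w ≡ false
      unburnt-vertex with FinP.¬∀⟶∃¬ N (λ v → b v ≡ true) (λ v → b v Bool.≟ true) not-all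
      ... | w , bw≢true = w , ¬-not bw≢true
      -- q has negative D, so it catches fire at once
      q-burnt : b q ≡ true
      q-burnt with b q in bq
      ... | true = refl
      ... | false = ⊥-elim (stopped (q , bq , ℤP.<-≤-trans Dq<0 (edgesTo-nonneg b q)))

-- Let S be the potentials f with D + lap f ≥ 0 away from q.  The weight
-- μ f = Σ (D + lap f)·h, with h the exponential potential, is bounded on S,
-- so some f ∈ S maximises it.  If (D + lap f)(q) ≥ 0, D would be equivalent to
-- an effective divisor.  Otherwise run the fire from q on D' = D + lap f: if
-- everything burns we are done; if an unburnt set remains, firing it keeps
-- f inside S and strictly increases μ, which is impossible.
module ReducedDivisors (G : Graph) (q : Fin (n G)) (reach : ∀ w → Reach G q w) where
  open Equivalence G
  open Orientation (edges G)
  open Potential G q using (Distance; distance; module Exponential)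
  private
    N : ℕ
    N = n G
    E : Edges N
    E = edges G

  BelowOrientation : Div G → Set
  BelowOrientation D = Σ (Div G) λ D' → Σ (Fin N → ℤ) λ ρ → D ≈ D' × Injective _≡_ _≡_ ρ × (∀ v → D' v ≤ ν ρ v)

  private
    -- firing the complement of b: the potential equal to 1 off b
    offSet : (Fin N → Bool) → Fin N → ℤ
    offSet b v = [ not (b v) ]

    not-1 : ∀ x → [ not x ] - 1ℤ ≡ - [ x ]
    not-1 true = refl
    not-1 false = refl

    lap-offSet-unburnt : ∀ b w → b w ≡ false → lap E (offSet b) w ≡ - Burning.edgesTo E (λ _ → 0ℤ) b w
    lap-offSet-unburnt b w bw = trans (lsum-cong E (λ { (x , y) → edge x y })) (lsum-neg E _)
      where
      ring : ∀ p q r s → p * - r + q * - s ≡ - (q * s + p * r)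
      ring = solve-∀
      edge : ∀ x y → lapEdge (x , y) (offSet b) w ≡ - (δ x w * [ b y ] + δ y w * [ b x ])
      edge x y = trans (cong₂ (λ r s → δ y w * ([ not (b x) ] - r) + δ x w * ([ not (b y) ] - s)) (cong [_] (cong not bw)) (cong [_] (cong not bw)))
                 (trans (cong₂ (λ r s → δ y w * r + δ x w * s) (not-1 (b x)) (not-1 (b y))) (ring (δ y w) (δ x w) [ b x ] [ b y ]))

    lap-offSet-burnt : ∀ b w → b w ≡ true → 0ℤ ≤ lap E (offSet b) w
    lap-offSet-burnt b w bw = subst (_≤ lap E (offSet b) w) (lsum-zero E) (lsum-mono E (λ { (x , y) → edge x y }))
      where
      edge : ∀ x y → 0ℤ ≤ lapEdge (x , y) (offSet b) w
      edge x y = subst (0ℤ ≤_) (cong₂ (λ r s → δ y w * ([ not (b x) ] - r) + δ x w * ([ not (b y) ] - s)) (sym (cong [_] (cong not bw))) (sym (cong [_] (cong not bw))))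
        (subst (0ℤ ≤_) (cong₂ _+_ (cong (δ y w *_) (sym (ℤP.+-identityʳ [ not (b x) ]))) (cong (δ x w *_) (sym (ℤP.+-identityʳ [ not (b y) ]))))
          (0≤+ (0≤* ([]-nonneg (eqᵇ y w)) ([]-nonneg (not (b x)))) (0≤* ([]-nonneg (eqᵇ x w)) ([]-nonneg (not (b y))))))

  module Maximal (dist : Distance) (D : Div G) (¬eff : ¬ EquivEff G D) where
    open Exponential dist using (h; h≥0; h≤h-q; lap-h≥1)

    Admissible : (Fin N → ℤ) → Set
    Admissible f = ∀ w → ¬ w ≡ q → 0ℤ ≤ D w + lap E f w

    μ : (Fin N → ℤ) → ℤ
    μ f = sum (λ w → (D w + lap E f w) * h w)

    ≈-fired : ∀ f → D ≈ (λ w → D w + lap E f w)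
    ≈-fired f = (λ v → - f v) by λ w → sym (trans (cong (λ s → D w + lap E f w + s) (lap-neg E f w)) (ring (D w) (lap E f w)))
      where
      ring : ∀ a b → a + b + - b ≡ a
      ring = solve-∀

    -- a large multiple of h makes D admissible
    C : ℤ
    C = sum (λ w → + ℤ.∣ D w ∣)

    start : Fin N → ℤ
    start v = C * h v

    admissible-start : Admissible start
    admissible-start w w≢q = ℤP.≤-trans (0≤x+∣x∣ (D w))
      (ℤP.≤-trans (ℤP.+-mono-≤ (ℤP.≤-refl {D w}) (sum-single w (λ w → + ℤ.∣ D w ∣) (λ _ _ → nonneg _)))
      (ℤP.≤-trans (ℤP.+-mono-≤ (ℤP.≤-refl {D w}) (ℤP.≤-trans (ℤP.≤-reflexive (sym (ℤP.*-identityʳ C))) (*-monoˡ-≤ C≥0 (lap-h≥1 w w≢q))))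
                  (ℤP.≤-reflexive (cong (λ s → D w + s) (sym (lap-* E C h w))))))
      where
      C≥0 : 0ℤ ≤ C
      C≥0 = sum-nonneg {f = λ w → + ℤ.∣ D w ∣} (λ w → nonneg _)
      0≤x+∣x∣ : ∀ x → 0ℤ ≤ x + + ℤ.∣ x ∣
      0≤x+∣x∣ x = ≤-by-difference (+ ℤ.∣ x ∣ - - x) (ℤP.i≤j⇒0≤j-i (subst (- x ≤_) (cong +_ (ℤP.∣-i∣≡∣i∣ x)) (i≤∣i∣ (- x)))) (ring x (+ ℤ.∣ x ∣))
        where
        ring : ∀ x a → a - - x ≡ x + a - 0ℤ
        ring = solve-∀

    μ-bounded : ∀ f → Admissible f → μ f ≤ sum D * h q
    μ-bounded f admissible = ℤP.≤-trans (sum-mono termwise) (ℤP.≤-reflexive (trans (sum-cong-≗ (λ w → ℤP.*-comm (D w + lap E f w) (h q)))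
        (trans (sum-*ˡ (h q) (λ w → D w + lap E f w)) (trans (cong (h q *_) (sym (≈-deg (≈-fired f)))) (ℤP.*-comm (h q) _)))))
      where
      termwise : ∀ w → (D w + lap E f w) * h w ≤ (D w + lap E f w) * h q
      termwise w with w FinP.≟ q
      ... | yes refl = ℤP.≤-refl
      ... | no w≢q = *-monoˡ-≤ (admissible w w≢q) (h≤h-q w)

    stuck-fire : ∀ f → Admissible f → (∀ g → Admissible g → μ g ≤ μ f) →
                 ∀ b → b q ≡ true → ∀ w₀ → b w₀ ≡ false →
                 (∀ v → b v ≡ false → Burning.edgesTo E (λ _ → 0ℤ) b v ≤ D v + lap E f v) → ⊥
    stuck-fire f admissible maximal b bq w₀ bw₀ stuck = ℤP.<-irrefl refl (ℤP.<-≤-trans (+1≤⇒< increase) (maximal f' admissible'))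
      where
      D' : Div G
      D' w = D w + lap E f w
      f' : Fin N → ℤ
      f' v = f v + offSet b v
      fired : ∀ w → D w + lap E f' w ≡ D' w + lap E (offSet b) w
      fired w = trans (cong (λ s → D w + s) (lap-+ E f (offSet b) w)) (sym (ℤP.+-assoc (D w) _ _))
      off-q : ∀ w → b w ≡ false → ¬ w ≡ q
      off-q w bw refl = case-false (trans (sym bw) bq)
        where
        case-false : ¬ false ≡ true
        case-false ()
      admissible' : Admissible f'
      admissible' w w≢q = subst (0ℤ ≤_) (sym (fired w)) (by-side (b w) refl)
        where
        by-side : (c : Bool) → b w ≡ c → 0ℤ ≤ D' w + lap E (offSet b) w
        by-side true bw = 0≤+ (admissible w w≢q) (lap-offSet-burnt b w bw)
        by-side false bw = subst (0ℤ ≤_) (cong (λ s → D' w + s) (sym (lap-offSet-unburnt b w bw))) (ℤP.i≤j⇒0≤j-i (stuck w bw))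
      -- μ grows by Σ_{unburnt} lap h ≥ 1
      gain-term : ∀ w → 0ℤ ≤ offSet b w * lap E h w
      gain-term w = by-side (b w) refl
        where
        by-side : (c : Bool) → b w ≡ c → 0ℤ ≤ offSet b w * lap E h w
        by-side true bw = subst (0ℤ ≤_) (sym (trans (cong (λ z → [ not z ] * lap E h w) bw) (ℤP.*-zeroˡ (lap E h w)))) ℤP.≤-refl
        by-side false bw = subst (0ℤ ≤_) (sym (trans (cong (λ z → [ not z ] * lap E h w) bw) (ℤP.*-identityˡ _)))
                                 (ℤP.≤-trans (nonneg 1) (lap-h≥1 w (off-q w bw)))
      gain : 1ℤ ≤ sum (λ w → offSet b w * lap E h w)
      gain = ℤP.≤-trans (ℤP.≤-trans (lap-h≥1 w₀ (off-q w₀ bw₀)) (ℤP.≤-reflexive (sym (trans (cong (λ z → [ not z ] * lap E h w₀) bw₀) (ℤP.*-identityˡ _)))))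
               (sum-single w₀ (λ w → offSet b w * lap E h w) (λ w _ → gain-term w))
      μ-fired : μ f' ≡ μ f + sum (λ w → offSet b w * lap E h w)
      μ-fired = trans (sum-cong-≗ (λ w → trans (cong (_* h w) (fired w)) (ℤP.*-distribʳ-+ (h w) (D' w) _)))
                (trans (∑-distrib-+ (λ w → D' w * h w) (λ w → lap E (offSet b) w * h w)) (cong (λ s → μ f + s)
                  (trans (sum-cong-≗ (λ w → ℤP.*-comm (lap E (offSet b) w) (h w))) (lap-selfadjoint E (offSet b) h))))
      increase : μ f + 1ℤ ≤ μ f'
      increase = subst (μ f + 1ℤ ≤_) (sym μ-fired) (ℤP.+-mono-≤ (ℤP.≤-refl {μ f}) gain)

    below : DN (BelowOrientation D)
    below = maximiser Admissible μ (sum D * h q) μ-bounded start admissible-start >>= λ { (f , admissible , maximal) → from-maximum f admissible maximal }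
      where
      from-maximum : ∀ f → Admissible f → (∀ g → Admissible g → μ g ≤ μ f) → DN (BelowOrientation D)
      from-maximum f admissible maximal with 0ℤ ℤP.≤? (D q + lap E f q)
      ... | yes 0≤at-q = λ _ → ¬eff ((λ w → D w + lap E f w) , effective , ≈⇒LinEquiv (≈-fired f))
        where
        effective : Effective G (λ w → D w + lap E f w)
        effective w with w FinP.≟ q
        ... | yes refl = 0≤at-q
        ... | no w≢q = admissible w w≢q
      ... | no at-q<0 = Burning.burning E (λ w → D w + lap E f w) q (ℤP.≰⇒> at-q<0) >>= λ
          { (inj₁ (ρ , ρ-inj , below-ν)) → return ((λ w → D w + lap E f w) , ρ , ≈-fired f , (λ {x} {y} → ρ-inj {x} {y}) , below-ν)
          ; (inj₂ (b , bq , (w₀ , bw₀) , stuck)) → λ _ → stuck-fire f admissible maximal b bq w₀ bw₀ stuck }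

  reduced : ∀ D → ¬ EquivEff G D → DN (BelowOrientation D)
  reduced D ¬eff = distance reach >>= λ dist → Maximal.below dist D ¬eff

-- The rank is computed by the orientation divisors:
--   r(D) + 1 = min over D' ≈ D and orderings ρ of deg⁺ (D' - ν ρ),
-- the inequality ≤ because ν ρ + lap f is never effective, and ≥ by reduced
-- divisors.  As K - ν ρ = ν (-ρ), the same D', ρ compute r(K - D) through
-- -(D' - ν ρ), and deg⁺ X - deg⁺ (-X) = deg X gives the theorem.
module RiemannRoch (G : Graph) (q : Fin (n G)) (reach : ∀ w → Reach G q w) where
  open Equivalence G
  open Orientation (edges G)
  open ReducedDivisors G q reach
  private
    N : ℕ
    N = n G
    E : Edges N
    E = edges G

  g-1 : ℤ
  g-1 = + length E - + N

  -- Upper bound: D' - (D' - ν ρ)⁺ ≤ ν ρ, and a divisor below ν ρ is not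
  -- equivalent to an effective one; so r(D) < deg⁺ (D' - ν ρ).
  rank<deg⁺ : ∀ {D r} → HasRank G D r → ∀ D' ρ → D ≈ D' → r + 1ℤ ≤ deg⁺ (D' ⊝ ν ρ)
  rank<deg⁺ {D} {r} hasRank D' ρ D≈D' = by-cases hasRank
    where
    X : Div G
    X = D' ⊝ ν ρ
    X⁺ : Div G
    X⁺ v = pos (X v)
    deg⁺≥0 : 0ℤ ≤ deg⁺ X
    deg⁺≥0 = sum-nonneg (λ v → pos-nonneg (X v))
    k : ℕ
    k = ℤ.∣ deg⁺ X ∣
    k≡deg⁺ : + k ≡ deg⁺ X
    k≡deg⁺ = ℤP.0≤i⇒+∣i∣≡i deg⁺≥0
    ¬rank≥k : RankAtLeast G D k → ⊥
    ¬rank≥k rank≥k with rank≥k X⁺ (λ v → pos-nonneg (X v)) (trans (deg≡sum X⁺) (sym k≡deg⁺))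
    ... | F , effF , D-X⁺~F with ≈-trans (≈-sym (≈-- X⁺ D≈D')) (LinEquiv⇒≈ {D ⊝ X⁺} {F} D-X⁺~F)
    ... | g by eq = ν-not-effective q ρ (λ v → - g v) (λ w → subst (0ℤ ≤_) (sym (rearranged w)) (0≤+ (effF w) (ℤP.i≤j⇒0≤j-i (pos-≥ (X w)))))
      where
      ring : ∀ d' x⁺ f nu → nu + - (d' - x⁺ - f) ≡ f + (x⁺ - (d' - nu))
      ring = solve-∀
      solve : ∀ d' x⁺ f l → d' - x⁺ ≡ f + l → l ≡ d' - x⁺ - f
      solve d' x⁺ f l e = sym (trans (cong (_- f) e) (cancel f l))
        where
        cancel : ∀ f l → f + l - f ≡ l
        cancel = solve-∀
      -- ν ρ - lap g = F + (X⁺ - X), which is effective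
      rearranged : ∀ w → ν ρ w + lap E (λ v → - g v) w ≡ F w + (X⁺ w - X w)
      rearranged w = trans (cong (λ s → ν ρ w + s) (lap-neg E g w))
        (trans (cong (λ l → ν ρ w + - l) (solve (D' w) (X⁺ w) (F w) (lap E g w) (eq w))) (ring (D' w) (X⁺ w) (F w) (ν ρ w)))
    by-cases : HasRank G D r → r + 1ℤ ≤ deg⁺ X
    by-cases (inj₁ (refl , _)) = deg⁺≥0
    by-cases (inj₂ (_ , k₀ , refl , rank≥k₀ , _)) with k ℕP.≤? k₀
    ... | yes k≤k₀ = ⊥-elim (¬rank≥k (RankAtLeast-≤ {D} q k≤k₀ rank≥k₀))
    ... | no k≰k₀ = subst (_≤ deg⁺ X) (trans (cong +_ (ℕP.+-comm 1 k₀)) (ℤP.pos-+ k₀ 1))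
                      (subst (+ suc k₀ ≤_) k≡deg⁺ (ℤ.+≤+ (ℕP.≰⇒> k≰k₀)))

  DN-∀-Vec : ∀ {m} {P : Vec (Fin N) m → Set} → (∀ xs → DN (P xs)) → DN (∀ xs → P xs)
  DN-∀-Vec {zero} dn = dn [] >>= λ p → return (λ { [] → p })
  DN-∀-Vec {suc m} {P} dn = DN-∀-Fin {N} {λ x → ∀ xs → P (x ∷ xs)} (λ x → DN-∀-Vec {m} {λ xs → P (x ∷ xs)} (λ xs → dn (x ∷ xs)))
    >>= λ f → return (λ { (x ∷ xs) → f x xs })

  -- Lower bound: if r(D) = k, some D - (x₁ + … + x_{k+1}) is not equivalent to an
  -- effective divisor; its reduced form D'' ≤ ν ρ gives D' = D'' + Σ xᵢ with
  -- deg⁺ (D' - ν ρ) ≤ k + 1.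
  rank-attained : ∀ {D r} → HasRank G D r → DN (Σ (Div G) λ D' → Σ (Fin N → ℤ) λ ρ →
                  D ≈ D' × Injective _≡_ _≡_ ρ × deg⁺ (D' ⊝ ν ρ) ≤ r + 1ℤ)
  rank-attained {D} (inj₁ (refl , ¬eff)) = reduced D ¬eff >>= λ { (D' , ρ , D≈D' , ρ-inj , D'≤ν) →
     return (D' , ρ , D≈D' , (λ {x} {y} → ρ-inj {x} {y}) ,
             ℤP.≤-reflexive (trans (sum-cong-≗ (λ v → pos-nonpos (ℤP.i≤j⇒i-j≤0 (D'≤ν v)))) (sum-zero {N}))) }
  rank-attained {D} (inj₂ (_ , k , refl , rank≥k , maximal)) = failing >>= λ { (xs , ¬eff) →
     reduced (D ⊝ vertexSum xs) ¬eff >>= λ { (D'' , ρ , D-xs≈D'' , ρ-inj , D''≤ν) →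
     return ((λ v → D'' v + vertexSum xs v) , ρ ,
             ≈-trans (≈-pointwise (λ v → sym (cancel (D v) (vertexSum xs v)))) (≈-+ (vertexSum xs) D-xs≈D'') , (λ {x} {y} → ρ-inj {x} {y}) ,
             ℤP.≤-trans (sum-mono (λ v → pos-least (excess (D'' v) (vertexSum xs v) (ν ρ v) (D''≤ν v)) (vertexSum-effective xs v)))
                        (ℤP.≤-reflexive (trans (vertexSum-deg xs) (trans (cong +_ (ℕP.+-comm 1 k)) (ℤP.pos-+ k 1))))) } }
    where
    cancel : ∀ a b → a + - b + b ≡ a
    cancel = solve-∀
    excess : ∀ d s nu → d ≤ nu → d + s - nu ≤ s
    excess d s nu d≤nu = ≤-by-difference (nu - d) (ℤP.i≤j⇒0≤j-i d≤nu) (ring d s nu)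
      where
      ring : ∀ d s nu → nu - d ≡ s - (d + s - nu)
      ring = solve-∀
    all-equiv-eff : (∀ xs → EquivEff G (D ⊝ vertexSum xs)) → RankAtLeast G D (suc k)
    all-equiv-eff all X effX degX with effective-as-vertexSum (suc k) X effX (trans (sym (deg≡sum X)) degX)
    ... | xs , X≡xs = EquivEff-resp (≈-pointwise (λ v → cong (λ z → D v - z) (sym (X≡xs v)))) (all xs)
    failing : DN (Σ (Vec (Fin N) (suc k)) λ xs → ¬ EquivEff G (D ⊝ vertexSum xs))
    failing none = DN-∀-Vec {suc k} {λ xs → EquivEff G (D ⊝ vertexSum xs)} (λ xs ¬eff → none (xs , ¬eff))
                     (λ all → ℕP.<-irrefl refl (maximal (suc k) (all-equiv-eff all)))

  module _ (loopless : Loopless) where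

    private
      ρ₀ : Fin N → ℤ
      ρ₀ v = + Fin.toℕ v

      ρ₀-inj : Injective _≡_ _≡_ ρ₀
      ρ₀-inj e = FinP.toℕ-injective (ℤP.+-injective e)

      neg-inj : ∀ {ρ : Fin N → ℤ} → Injective _≡_ _≡_ ρ → Injective _≡_ _≡_ (λ w → - ρ w)
      neg-inj ρ-inj e = ρ-inj (ℤP.neg-injective e)

    -- deg K = 2g - 2, from K = ν ρ₀ + ν (-ρ₀).
    deg-canonical : sum canonical ≡ g-1 + g-1
    deg-canonical = trans (sum-cong-≗ (λ v → sym (trans (cong (λ s → ν ρ₀ v + s) (sym (canonical-ν loopless ρ₀ ρ₀-inj v))) (ring (canonical v) (ν ρ₀ v)))))
      (trans (∑-distrib-+ (ν ρ₀) (ν (λ w → - ρ₀ w))) (cong₂ _+_ (deg-ν loopless ρ₀ ρ₀-inj) (deg-ν loopless (λ w → - ρ₀ w) (neg-inj {ρ₀} ρ₀-inj))))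
      where
      ring : ∀ k a → a + (k - a) ≡ k
      ring = solve-∀

    -- With D' ≈ A and ρ attaining r(A) + 1 ≥ deg⁺(D' - ν ρ), the pair K - D', -ρ
    -- bounds r(K - A):  r(K - A) + 1 ≤ deg⁺(ν ρ - D') = deg⁺(D' - ν ρ) - (deg A - (g - 1)).
    dual-bound : ∀ {A D' ρ s t} → A ≈ D' → Injective _≡_ _≡_ ρ → deg⁺ (D' ⊝ ν ρ) ≤ s + 1ℤ → HasRank G (canonical ⊝ A) t →
                 t + 1ℤ ≤ s + 1ℤ - (sum A - g-1)
    dual-bound {A} {D'} {ρ} {s} {t} A≈D' ρ-inj attained hasRank =
      ℤP.≤-trans (rank<deg⁺ hasRank (canonical ⊝ D') (λ w → - ρ w) K-A≈K-D')
      (ℤP.≤-trans (ℤP.≤-reflexive (trans (sum-cong-≗ (λ v → cong pos (reversed v))) (sym deg⁺-neg)))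
                  (ℤP.+-mono-≤ attained (ℤP.≤-reflexive (cong -_ deg-X))))
      where
      X : Div G
      X = D' ⊝ ν ρ
      K-A≈K-D' : (canonical ⊝ A) ≈ (canonical ⊝ D')
      K-A≈K-D' = ≈-trans (≈-pointwise (λ v → ℤP.+-comm (canonical v) (- A v)))
                   (≈-trans (≈-+ canonical (≈-neg A≈D')) (≈-pointwise (λ v → ℤP.+-comm (- D' v) (canonical v))))
      reversed : ∀ v → (canonical ⊝ D') v - ν (λ w → - ρ w) v ≡ - X v
      reversed v = trans (cong (λ z → canonical v - D' v - z) (sym (canonical-ν loopless ρ ρ-inj v))) (ring (canonical v) (D' v) (ν ρ v))
        where
        ring : ∀ k a nu → k - a - (k - nu) ≡ - (a - nu)
        ring = solve-∀
      deg⁺-neg : deg⁺ X + - sum X ≡ deg⁺ (λ v → - X v)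
      deg⁺-neg = trans (cong (λ z → deg⁺ X + - z) (sym (deg⁺-split X))) (ring (deg⁺ X) (deg⁺ (λ v → - X v)))
        where
        ring : ∀ a b → a + - (a - b) ≡ b
        ring = solve-∀
      deg-X : sum X ≡ sum A - g-1
      deg-X = trans (sum-- D' (ν ρ)) (cong₂ _-_ (sym (≈-deg A≈D')) (deg-ν loopless ρ ρ-inj))

    riemann-roch : ∀ {D r r'} → HasRank G D r → HasRank G (canonical ⊝ D) r' → r - r' ≡ sum D - g-1
    riemann-roch {D} {r} {r'} hasRank hasRank' = DN-elim-dec (r - r' ℤP.≟ sum D - g-1)
      (rank-attained hasRank >>= λ { (D₁ , ρ₁ , D≈D₁ , ρ₁-inj , attained₁) →
       rank-attained hasRank' >>= λ { (D₂ , ρ₂ , K-D≈D₂ , ρ₂-inj , attained₂) →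
       return (antisym (dual-bound {s = r} D≈D₁ (λ {x} {y} → ρ₁-inj {x} {y}) attained₁ hasRank')
                       (dual-bound {s = r'} K-D≈D₂ (λ {x} {y} → ρ₂-inj {x} {y}) attained₂ hasRank-KKD)) } })
      where
      hasRank-KKD : HasRank G (canonical ⊝ (canonical ⊝ D)) r
      hasRank-KKD = HasRank-resp (≈-pointwise (λ v → sym (ring (canonical v) (D v)))) hasRank
        where
        ring : ∀ k d → k - (k - d) ≡ d
        ring = solve-∀
      deg-K-D : sum (canonical ⊝ D) ≡ g-1 + g-1 - sum D
      deg-K-D = trans (sum-- canonical D) (cong (_- sum D) deg-canonical)
      antisym : r' + 1ℤ ≤ r + 1ℤ - (sum D - g-1) → r + 1ℤ ≤ r' + 1ℤ - (sum (canonical ⊝ D) - g-1) → r - r' ≡ sum D - g-1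
      antisym h₁ h₂ = ℤP.≤-antisym
        (≤-by-difference (r' + 1ℤ - (sum (canonical ⊝ D) - g-1) - (r + 1ℤ)) (ℤP.i≤j⇒0≤j-i h₂)
             (trans (cong (λ z → r' + 1ℤ - (z - g-1) - (r + 1ℤ)) deg-K-D) (ring₁ r r' (sum D) g-1)))
        (≤-by-difference (r + 1ℤ - (sum D - g-1) - (r' + 1ℤ)) (ℤP.i≤j⇒0≤j-i h₁) (ring₂ r r' (sum D) g-1))
        where
        ring₁ : ∀ r r' d e → r' + 1ℤ - (e + e - d - e) - (r + 1ℤ) ≡ d - e - (r - r')
        ring₁ = solve-∀
        ring₂ : ∀ r r' d e → r + 1ℤ - (d - e) - (r' + 1ℤ) ≡ r - r' - (d - e)
        ring₂ = solve-∀

private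
  δ-injective : ∀ {k m} (ι : Fin m → Fin k) → (∀ a b → ι a ≡ ι b → a ≡ b) → ∀ a b → δ (ι a) (ι b) ≡ δ a b
  δ-injective ι ι-inj a b with a Fin.≟ b
  ... | yes refl = δ-refl (ι a)
  ... | no a≢b = δ-ne (λ e → a≢b (ι-inj a b e))

  δ-diff : ∀ {k} (x y : Fin k) (g : Fin k → ℤ) → δ x y * (g x - g y) ≡ 0ℤ
  δ-diff x y g with x Fin.≟ y
  ... | yes refl = trans (ℤP.*-identityˡ _) (ℤP.+-inverseʳ (g x))
  ... | no _ = ℤP.*-zeroˡ (g x - g y)

  shift : ∀ {k} → Fin k × Fin k → Fin (suc k) × Fin (suc k)
  shift e = (suc (proj₁ e) , suc (proj₂ e))

module Subdivision (m : ℕ) where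

  NewVertex : (h : HatData m) → Fin (HatData.size h) → Set
  NewVertex h x = (∀ D → HatData.ext h D x ≡ 0ℤ) × (∀ v → ¬ x ≡ HatData.emb h v)
                × (valency (HatData.hedges h) x ≡ + 2) × (Σ (Fin m) λ a → (HatData.emb h a , x) ∈ HatData.hedges h)

  record Invariant (es : List (Fin m × Fin m)) (h : HatData m) : Set where
    private
      ι : Fin m → Fin (HatData.size h)
      ι = HatData.emb h
      E' : Edges (HatData.size h)
      E' = HatData.hedges h
    field
      emb-injective : ∀ a b → ι a ≡ ι b → a ≡ b
      loopless : ∀ e → e ∈ E' → ¬ proj₁ e ≡ proj₂ e
      old-or-new : ∀ x → (Σ (Fin m) λ v → x ≡ ι v) ⊎ NewVertex h x
      ext-emb : ∀ D v → HatData.ext h D (ι v) ≡ D v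
      valency-emb : ∀ v → valency E' (ι v) ≡ valency es v
      count : length E' ℕ.+ m ≡ length es ℕ.+ HatData.size h
      ext-deg : ∀ D → sum (HatData.ext h D) ≡ sum D
      edge-kept : ∀ a b → (a , b) ∈ es → ¬ a ≡ b → (ι a , ι b) ∈ E'
      extend-potential : ∀ f → Σ (Fin (HatData.size h) → ℤ) λ f' → (∀ v → f' (ι v) ≡ f v)
                           × (∀ v → lap E' f' (ι v) ≡ lap es f v)
                           × (∀ x → (∀ v → ¬ x ≡ ι v) → lap E' f' x ≡ 0ℤ)

  open Invariant

  private
    invariant-[] : Invariant [] (hd m [] id id)
    invariant-[] = record
      { emb-injective = λ a b e → e
      ; loopless = λ e ()
      ; old-or-new = λ x → inj₁ (x , refl)
      ; ext-emb = λ D v → refl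
      ; valency-emb = λ v → refl
      ; count = refl
      ; ext-deg = λ D → refl
      ; edge-kept = λ a b ()
      ; extend-potential = λ f → f , (λ v → refl) , (λ v → refl) , (λ x x-new → ⊥-elim (x-new x refl))
      }

    hatStep-loop : ∀ (a : Fin m) s E' ι ex →
      hatStep (a , a) (hd s E' ι ex) ≡ hd (suc s) ((suc (ι a) , zero) ∷ (zero , suc (ι a)) ∷ map shift E') (suc ∘ ι) (ext0 ∘ ex)
    hatStep-loop a s E' ι ex with a Fin.≟ a
    ... | yes _ = refl
    ... | no a≢a = ⊥-elim (a≢a refl)

    hatStep-edge : ∀ (a b : Fin m) s E' ι ex → ¬ a ≡ b → hatStep (a , b) (hd s E' ι ex) ≡ hd s ((ι a , ι b) ∷ E') ι ex
    hatStep-edge a b s E' ι ex a≢b with a Fin.≟ b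
    ... | yes a≡b = ⊥-elim (a≢b a≡b)
    ... | no _ = refl

    invariant-loop : ∀ a es s E' ι ex → Invariant es (hd s E' ι ex) → Invariant ((a , a) ∷ es) (hatStep (a , a) (hd s E' ι ex))
    invariant-loop a es s E' ι ex I = subst (Invariant ((a , a) ∷ es)) (sym (hatStep-loop a s E' ι ex)) record
      { emb-injective = λ x y e → emb-injective I x y (FinP.suc-injective e)
      ; loopless = loopless'
      ; old-or-new = old-or-new'
      ; ext-emb = λ D v → ext-emb I D v
      ; valency-emb = valency-emb'
      ; count = count'
      ; ext-deg = λ D → trans (ℤP.+-identityˡ _) (ext-deg I D)
      ; edge-kept = edge-kept'
      ; extend-potential = extend'
      }
      where
      h' : HatData m
      h' = hd (suc s) ((suc (ι a) , zero) ∷ (zero , suc (ι a)) ∷ map shift E') (suc ∘ ι) (ext0 ∘ ex)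
      E'' : Edges (suc s)
      E'' = HatData.hedges h'
      loopless' : ∀ e → e ∈ E'' → ¬ proj₁ e ≡ proj₂ e
      loopless' e (here refl) ()
      loopless' e (there (here refl)) ()
      loopless' e (there (there e∈)) with ∈-map⁻ shift e∈
      ... | e₀ , e₀∈ , refl = λ same → loopless I e₀ e₀∈ (FinP.suc-injective same)
      valency-suc : ∀ y → valency E'' (suc y) ≡ δ (ι a) y + δ (ι a) y + valency E' y
      valency-suc y = trans (cong (λ z → δ (ι a) y + 0ℤ + (0ℤ + δ (ι a) y + z)) (lsum-map shift E' _)) (ring (δ (ι a) y) (valency E' y))
        where
        ring : ∀ d v → d + 0ℤ + (0ℤ + d + v) ≡ d + d + v
        ring = solve-∀
      valency-zero : lsum (map shift E') (λ e → δ (proj₁ e) zero + δ (proj₂ e) zero) ≡ 0ℤ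
      valency-zero = trans (lsum-map shift E' _) (lsum-zero E')
      old-or-new' : ∀ x → (Σ (Fin m) λ v → x ≡ suc (ι v)) ⊎ NewVertex h' x
      old-or-new' zero = inj₂ ((λ D → refl) , (λ v ()) , cong (λ z → 0ℤ + 1ℤ + (1ℤ + 0ℤ + z)) valency-zero , (a , here refl))
      old-or-new' (suc y) with old-or-new I y
      ... | inj₁ (v , y≡) = inj₁ (v , cong suc y≡)
      ... | inj₂ (ext≡0 , not-old , val≡2 , (a₀ , a₀y∈)) = inj₂ (ext≡0 , (λ v e → not-old v (FinP.suc-injective e)) ,
            trans (valency-suc y) (trans (cong₂ (λ p r → p + p + r) (δ-ne (λ e → not-old a (sym e))) val≡2) refl) ,
            (a₀ , there (there (∈-map⁺ shift a₀y∈))))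
      valency-emb' : ∀ v → valency E'' (suc (ι v)) ≡ valency ((a , a) ∷ es) v
      valency-emb' v = trans (valency-suc (ι v)) (cong₂ (λ p r → p + p + r) (δ-injective ι (emb-injective I) a v) (valency-emb I v))
      count' : suc (suc (length (map shift E'))) ℕ.+ m ≡ suc (length es) ℕ.+ suc s
      count' = cong suc (trans (cong (λ z → suc (z ℕ.+ m)) (LP.length-map shift E'))
                     (trans (cong suc (count I)) (sym (ℕP.+-suc (length es) s))))
      edge-kept' : ∀ a' b' → (a' , b') ∈ (a , a) ∷ es → ¬ a' ≡ b' → (suc (ι a') , suc (ι b')) ∈ E''
      edge-kept' a' b' (here refl) a≢a = ⊥-elim (a≢a refl)
      edge-kept' a' b' (there ab∈) a'≢b' = there (there (∈-map⁺ shift (edge-kept I a' b' ab∈ a'≢b')))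
      -- give the new vertex the value at a, so the new edges contribute nothing
      extend' : ∀ f → Σ (Fin (suc s) → ℤ) λ f' → (∀ v → f' (suc (ι v)) ≡ f v)
                 × (∀ v → lap E'' f' (suc (ι v)) ≡ lap ((a , a) ∷ es) f v)
                 × (∀ x → (∀ v → ¬ x ≡ suc (ι v)) → lap E'' f' x ≡ 0ℤ)
      extend' f with extend-potential I f
      ... | f' , f'≡f , lap-old , lap-new = f'' , f'≡f , lap-old' , lap-new'
        where
        f'' : Fin (suc s) → ℤ
        f'' zero = f' (ι a)
        f'' (suc y) = f' y
        new-edges : ∀ w → lap E'' f'' w ≡ lsum (map shift E') (λ e → lapEdge e f'' w)
        new-edges w = trans (cong₂ (λ p r → p + (r + lsum (map shift E') (λ e → lapEdge e f'' w)))
                         (cong₂ _+_ (δ-diff zero w f'') (δ-diff (suc (ι a)) w f''))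
                         (cong₂ _+_ (δ-diff (suc (ι a)) w f'') (δ-diff zero w f'')))
                     (ring (lsum (map shift E') (λ e → lapEdge e f'' w)))
          where
          ring : ∀ t → 0ℤ + 0ℤ + (0ℤ + 0ℤ + t) ≡ t
          ring = solve-∀
        lap-old' : ∀ v → lap E'' f'' (suc (ι v)) ≡ lap ((a , a) ∷ es) f v
        lap-old' v = trans (new-edges (suc (ι v))) (trans (lsum-map shift E' (λ e → lapEdge e f'' (suc (ι v))))
                      (trans (lap-old v) (sym (trans (cong (λ z → z + lap es f v) (lapEdge-loop a f v)) (ℤP.+-identityˡ _)))))
        lap-new' : ∀ x → (∀ v → ¬ x ≡ suc (ι v)) → lap E'' f'' x ≡ 0ℤ
        lap-new' zero _ = trans (new-edges zero) (trans (lsum-map shift E' (λ e → lapEdge e f'' zero))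
                          (trans (lsum-cong E' (λ e → cong₂ _+_ (ℤP.*-zeroˡ (f' (proj₁ e) - f'' zero)) (ℤP.*-zeroˡ (f' (proj₂ e) - f'' zero)))) (lsum-zero E')))
        lap-new' (suc y) not-old = trans (new-edges (suc y)) (trans (lsum-map shift E' (λ e → lapEdge e f'' (suc y)))
                          (lap-new y (λ v e → not-old v (cong suc e))))

    invariant-edge : ∀ a b es s E' ι ex → Invariant es (hd s E' ι ex) → ¬ a ≡ b → Invariant ((a , b) ∷ es) (hatStep (a , b) (hd s E' ι ex))
    invariant-edge a b es s E' ι ex I a≢b = subst (Invariant ((a , b) ∷ es)) (sym (hatStep-edge a b s E' ι ex a≢b)) record
      { emb-injective = emb-injective I
      ; loopless = loopless'
      ; old-or-new = old-or-new'
      ; ext-emb = ext-emb I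
      ; valency-emb = λ v → cong₂ _+_ (cong₂ _+_ (δ-injective ι (emb-injective I) a v) (δ-injective ι (emb-injective I) b v)) (valency-emb I v)
      ; count = cong suc (count I)
      ; ext-deg = ext-deg I
      ; edge-kept = edge-kept'
      ; extend-potential = extend'
      }
      where
      E'' : Edges s
      E'' = (ι a , ι b) ∷ E'
      loopless' : ∀ e → e ∈ E'' → ¬ proj₁ e ≡ proj₂ e
      loopless' e (here refl) same = a≢b (emb-injective I a b same)
      loopless' e (there e∈) = loopless I e e∈
      old-or-new' : ∀ x → (Σ (Fin m) λ v → x ≡ ι v) ⊎ NewVertex (hd s E'' ι ex) x
      old-or-new' x with old-or-new I x
      ... | inj₁ old = inj₁ old
      ... | inj₂ (ext≡0 , not-old , val≡2 , (a₀ , a₀x∈)) = inj₂ (ext≡0 , not-old ,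
            trans (cong₂ (λ p r → p + r + valency E' x) (δ-ne (λ e → not-old a (sym e))) (δ-ne (λ e → not-old b (sym e)))) (trans (ℤP.+-identityˡ _) val≡2) ,
            (a₀ , there a₀x∈))
      edge-kept' : ∀ a' b' → (a' , b') ∈ (a , b) ∷ es → ¬ a' ≡ b' → (ι a' , ι b') ∈ E''
      edge-kept' a' b' (here refl) _ = here refl
      edge-kept' a' b' (there ab∈) a'≢b' = there (edge-kept I a' b' ab∈ a'≢b')
      extend' : ∀ f → Σ (Fin s → ℤ) λ f' → (∀ v → f' (ι v) ≡ f v)
                 × (∀ v → lap E'' f' (ι v) ≡ lap ((a , b) ∷ es) f v)
                 × (∀ x → (∀ v → ¬ x ≡ ι v) → lap E'' f' x ≡ 0ℤ)
      extend' f with extend-potential I f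
      ... | f' , f'≡f , lap-old , lap-new = f' , f'≡f , lap-old' , lap-new'
        where
        lap-old' : ∀ v → lap E'' f' (ι v) ≡ lap ((a , b) ∷ es) f v
        lap-old' v = cong₂ _+_ (cong₂ _+_ (cong₂ _*_ (δ-injective ι (emb-injective I) b v) (cong₂ _-_ (f'≡f a) (f'≡f v)))
                                          (cong₂ _*_ (δ-injective ι (emb-injective I) a v) (cong₂ _-_ (f'≡f b) (f'≡f v)))) (lap-old v)
        lap-new' : ∀ x → (∀ v → ¬ x ≡ ι v) → lap E'' f' x ≡ 0ℤ
        lap-new' x not-old = trans (cong₂ _+_ (cong₂ _+_ (cong (_* (f' (ι a) - f' x)) (δ-ne (λ e → not-old b (sym e))))
                                                       (cong (_* (f' (ι b) - f' x)) (δ-ne (λ e → not-old a (sym e))))) (lap-new x not-old))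
                             (trans (ℤP.+-identityʳ _) (cong₂ _+_ (ℤP.*-zeroˡ (f' (ι a) - f' x)) (ℤP.*-zeroˡ (f' (ι b) - f' x))))

    invariant-cons : ∀ a b es s E' ι ex → Invariant es (hd s E' ι ex) → Dec (a ≡ b) →
                     Invariant ((a , b) ∷ es) (hatStep (a , b) (hd s E' ι ex))
    invariant-cons a .a es s E' ι ex I (yes refl) = invariant-loop a es s E' ι ex I
    invariant-cons a b es s E' ι ex I (no a≢b) = invariant-edge a b es s E' ι ex I a≢b

  invariant : ∀ es → Invariant es (hatData m es)
  invariant [] = invariant-[]
  invariant ((a , b) ∷ es) with hatData m es | invariant es
  ... | hd s E' ι ex | I = invariant-cons a b es s E' ι ex I (a Fin.≟ b)

weightLoops : ∀ {m} → (Fin m → ℕ) → List (Fin m) → List (Fin m × Fin m)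
weightLoops ω = concatMap (λ v → replicate (ω v) (v , v))

weightLoops-length : ∀ {m} (ω : Fin m → ℕ) (L : List (Fin m)) → length (weightLoops ω L) ≡ sumℕ (map ω L)
weightLoops-length ω [] = refl
weightLoops-length ω (x ∷ L) =
  trans (LP.length-++ (replicate (ω x) (x , x))) (cong₂ ℕ._+_ (LP.length-replicate (ω x)) (weightLoops-length ω L))

-- Loops do not change the Laplacian, so G and G^ω have the same principal divisors.
lap-weightLoops : ∀ {m} (ω : Fin m → ℕ) (L : List (Fin m)) (f : Fin m → ℤ) (w : Fin m) → lap (weightLoops ω L) f w ≡ 0ℤ
lap-weightLoops ω [] f w = refl
lap-weightLoops ω (x ∷ L) f w = trans (lsum-++ (replicate (ω x) (x , x)) _ (λ e → lapEdge e f w))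
    (cong₂ _+_ (copies (ω x)) (lap-weightLoops ω L f w))
  where
  copies : ∀ k → lap (replicate k (x , x)) f w ≡ 0ℤ
  copies zero = refl
  copies (suc k) = cong₂ _+_ (lapEdge-loop x f w) (copies k)

lap-virtual : (G : Graph) (ω : Weight G) (f : Fin (n G) → ℤ) (w : Fin (n G)) → lap (edges (virtual G ω)) f w ≡ lap (edges G) f w
lap-virtual G ω f w = trans (lsum-++ (edges G) _ (λ e → lapEdge e f w))
  (trans (cong (λ s → lap (edges G) f w + s) (lap-weightLoops ω (allFin (n G)) f w)) (ℤP.+-identityʳ _))

module Weighted (G : Graph) (conn : Connected G) (ω : Weight G) where
  V : Graph
  V = virtual G ω
  hV : HatData (n G)
  hV = hatData (n G) (edges V)
  H : Graph
  H = hat V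
  open Subdivision (n G)
  open Invariant (invariant (edges V))
  ι : Fin (n G) → Fin (n H)
  ι = HatData.emb hV
  ext : Div G → Div H
  ext = HatData.ext hV
  q₀ : Fin (n H)
  q₀ = ι (proj₁ conn)

  private
    -- an edge of G^ω is either a loop or survives in H
    lift-edge : ∀ {u v w} → Reach H (ι u) (ι v) → (v , w) ∈ edges V ⊎ (w , v) ∈ edges V → Reach H (ι u) (ι w)
    lift-edge {v = v} {w} path v~w with v Fin.≟ w
    ... | yes refl = path
    ... | no v≢w = step path (kept v~w)
      where
      kept : (v , w) ∈ edges V ⊎ (w , v) ∈ edges V → (ι v , ι w) ∈ edges H ⊎ (ι w , ι v) ∈ edges H
      kept (inj₁ vw∈) = inj₁ (edge-kept _ _ vw∈ v≢w)
      kept (inj₂ wv∈) = inj₂ (edge-kept _ _ wv∈ (λ w≡v → v≢w (sym w≡v)))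

    lift : ∀ {u v} → Reach G u v → Reach H (ι u) (ι v)
    lift here = here
    lift (step p (inj₁ vw∈)) = lift-edge (lift p) (inj₁ (∈-++⁺ˡ vw∈))
    lift (step p (inj₂ wv∈)) = lift-edge (lift p) (inj₂ (∈-++⁺ˡ wv∈))

  -- every new vertex hangs off an old one
  connected : ∀ x → Reach H q₀ x
  connected x with old-or-new x
  ... | inj₁ (v , refl) = lift (proj₂ conn (proj₁ conn) v)
  ... | inj₂ (_ , _ , _ , (a , ax∈)) = step (lift (proj₂ conn (proj₁ conn) a)) (inj₁ ax∈)

  open Orientation (edges H) using (Loopless; canonical)

  H-loopless : Loopless
  H-loopless = loopless

  -- K_(G,ω) extended by zero is K_H: old vertices keep their valency in G^ω,
  -- new ones have valency 2.
  canonical-transfer : ∀ D x → ext (KW G ω ⊝ D) x ≡ (canonical ⊝ ext D) x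
  canonical-transfer D x with old-or-new x
  ... | inj₁ (v , refl) = trans (ext-emb (KW G ω ⊝ D) v)
          (cong₂ (λ k d → k - + 2 - d) (trans (valℤ V v) (sym (valency-emb v))) (sym (ext-emb D v)))
  ... | inj₂ (ext≡0 , _ , val≡2 , _) = trans (ext≡0 (KW G ω ⊝ D)) (sym (cong₂ (λ k d → k - + 2 - d) val≡2 (ext≡0 D)))

  degree-transfer : ∀ D → sum (ext D) - (+ length (edges H) - + n H) ≡ deg G D - genus G ω + + 1
  degree-transfer D = trans (cong (λ d → d - (+ length (edges H) - + n H)) (trans (ext-deg D) (sym (Σᵥ≡sum D))))
    (ring (deg G D) (+ length (edges H)) (+ n G) (+ length (edges G)) (+ sumℕ (map ω (allFin (n G)))) (+ n H)
          (Σᵥ (λ v → + ω v)) counted (sym (sumℕ-lsum (allFin (n G)) ω)))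
    where
    counted : + length (edges H) + + n G ≡ + length (edges G) + + sumℕ (map ω (allFin (n G))) + + n H
    counted = trans (sym (ℤP.pos-+ (length (edges H)) (n G)))
      (trans (cong +_ (trans count (cong (ℕ._+ n H) (trans (LP.length-++ (edges G)) (cong (length (edges G) ℕ.+_) (weightLoops-length ω (allFin (n G))))))))
      (trans (ℤP.pos-+ _ (n H)) (cong (_+ + n H) (ℤP.pos-+ (length (edges G)) _))))
    ring : ∀ d eH v eG w vH sw → eH + v ≡ eG + w + vH → sw ≡ w → d - (eH - vH) ≡ d - (eG - v + + 1 + sw) + + 1
    ring d eH v eG w vH sw e₁ refl = trans (cong (λ z → d - (z - vH)) (sym (cancel eH v)))
      (trans (cong (λ z → d - (z - v - vH)) e₁) (rearrange d eG w vH v))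
      where
      cancel : ∀ a b → a + b - b ≡ a
      cancel = solve-∀
      rearrange : ∀ d eG w vH v → d - (eG + w + vH - v - vH) ≡ d - (eG - v + + 1 + w) + + 1
      rearrange = solve-∀

  open Equivalence H using (_≈_; _by_)

  -- Linear equivalence on G lifts to H: extend the potential to H.
  equivalence-transfer : ∀ D D' → LinEquiv G D D' → ext D ≈ ext D'
  equivalence-transfer D D' D~D' with Equivalence.LinEquiv⇒≈ G D~D'
  ... | f by eq with extend-potential f
  ... | f' , _ , lap-old , lap-new = f' by pointwise
    where
    pointwise : ∀ x → ext D x ≡ ext D' x + lap (edges H) f' x
    pointwise x with old-or-new x
    ... | inj₁ (v , refl) = trans (ext-emb D v) (trans (eq v)
            (sym (cong₂ _+_ (ext-emb D' v) (trans (lap-old v) (lap-virtual G ω f v)))))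
    ... | inj₂ (ext≡0 , not-old , _) = trans (ext≡0 D) (sym (trans (cong₂ _+_ (ext≡0 D') (lap-new x not-old)) refl))

theorem3p8 : (G : Graph) → Connected G → (ω : Weight G) →
    ((D : Div G) (r r' : ℤ) → HasRankW G ω D r → HasRankW G ω (KW G ω ⊝ D) r' →
    r - r' ≡ deg G D - genus G ω + + 1)
    × ((D D' : Div G) (r r' : ℤ) → LinEquiv G D D' →
    HasRankW G ω D r → HasRankW G ω D' r' → r ≡ r')
theorem3p8 G conn ω = riemann-roch-weighted , rank-invariant
  where
  open Weighted G conn ω
  open Equivalence H using (HasRank-resp; HasRank-unique; ≈-pointwise)
  open RiemannRoch H q₀ connected using (riemann-roch)

  riemann-roch-weighted : (D : Div G) (r r' : ℤ) → HasRankW G ω D r → HasRankW G ω (KW G ω ⊝ D) r' →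
                          r - r' ≡ deg G D - genus G ω + + 1
  riemann-roch-weighted D r r' hasRank hasRank' =
    trans (riemann-roch H-loopless hasRank (HasRank-resp (≈-pointwise (canonical-transfer D)) hasRank')) (degree-transfer D)

  rank-invariant : (D D' : Div G) (r r' : ℤ) → LinEquiv G D D' → HasRankW G ω D r → HasRankW G ω D' r' → r ≡ r'
  rank-invariant D D' r r' D~D' hasRank hasRank' = HasRank-unique {ext D'} (HasRank-resp (equivalence-transfer D D' D~D') hasRank) hasRank'
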